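{- Let $k\ge4$ and $m=\lfloor\frac{k-1}{2}\rfloor$, and in $\mathbb{Z}[x,y]$ let $C_1(k)=\sum_{j=0}^{k}y^j+\sum_{i=1}^{k-1}x^i+m\,xy-m$, $C_2(k)=\sum_{i=0}^{k}x^i+\sum_{j=1}^{k-1}y^j+m\,xy-m$, $C_3(k)=x^2y+xy-x-1$, $C_4(k)=xy^2+xy-y-1$, $C_5(k)=(k-2)xy-(k-2)$. Then for all $1\le i<j\le5$ the S-polynomial $S(C_i(k),C_j(k))$ D-reduces to $0$ modulo $\{C_1(k),\dots,C_5(k)\}$, and $\{C_1(k),\dots,C_5(k)\}$ is a D-Gröbner basis.
   Context: Terms in $\mathbb{Z}[x,y]$ are ordered by degree-lexicographic order with $x>y$: $1<y<x<y^2<xy<x^2<y^3<\cdots$. For $P\neq0$, $HT(P)$, $HC(P)$, $HM(P)$ denote its leading term, leading coefficient and leading monomial. $f$ D-reduces to $g$ modulo $p$ if some monomial $m$ of $f$ equals $m'\cdot HM(p)$ for a monomial $m'$ with integer coefficient, and $g=f-m'p$; "$f$ D-reduces to $0$ modulo $G$" means a finite sequence of such reductions by elements of $G$ leads from $f$ to $0$. For $g_1,g_2\neq0$ with $a_i=HC(g_i)$, $t_i=HT(g_i)$, write $\mathrm{lcm}(a_1,a_2)=b_1a_1=b_2a_2$ and $\mathrm{lcm}(t_1,t_2)=s_1t_1=s_2t_2$; the S-polynomial is $S(g_1,g_2)=b_1s_1g_1-b_2s_2g_2$. A finite set $G$ is a D-Gröbner basis if every D-normal form modulo $G$ (result of reductions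 until none applies) of every element of the ideal generated by $G$ is $0$. -}

module Defs where

open import Data.Nat as ℕ using (ℕ; zero; suc; _∸_; _⊔_; _≤?_)
import Data.Nat.DivMod as ℕD
open import Data.Integer as ℤ using (ℤ; +_; 0ℤ; 1ℤ; -_)
open import Data.Integer.LCM using (lcm)
open import Data.Bool using (Bool; true; false; if_then_else_; _∧_)
open import Data.Product using (Σ; ∃; ∃-syntax; _×_; _,_; proj₁; proj₂)
open import Data.Sum using (_⊎_)
open import Data.Fin using (Fin)
import Data.Fin as Fin
open import Relation.Nullary using (¬_; does)
open import Relation.Binary.PropositionalEquality using (_≡_; _≢_)
open import Relation.Binary.Construct.Closure.ReflexiveTransitive using (Star)

-- Terms x^a y^b of Z[x,y] are pairs (a , b) of exponents.

Term : Set
Term = ℕ × ℕ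

_<T_ : Term → Term → Set
(a , b) <T (c , d) = (a ℕ.+ b ℕ.< c ℕ.+ d) ⊎ ((a ℕ.+ b ≡ c ℕ.+ d) × (a ℕ.< c))

_+T_ : Term → Term → Term
(a , b) +T (c , d) = (a ℕ.+ c , b ℕ.+ d)

lcmT : Term → Term → Term
lcmT (a , b) (c , d) = (a ⊔ c , b ⊔ d)

-- quotient s with s * t = u when t divides u
_-T_ : Term → Term → Term
(a , b) -T (c , d) = (a ∸ c , b ∸ d)

-- Polynomials: coefficient functions Term → ℤ.  (Every concrete object
-- below, and every ideal element, has finite support; equality is
-- pointwise equality of coefficients.)

Poly : Set
Poly = Term → ℤ

IsPoly : Poly → Set
IsPoly p = ∃[ d ] (∀ t → d ℕ.< proj₁ t ℕ.+ proj₂ t → p t ≡ 0ℤ)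

_≈P_ : Poly → Poly → Set
p ≈P q = ∀ t → p t ≡ q t

0P : Poly
0P _ = 0ℤ

mono : ℤ → ℕ → ℕ → Poly
mono c a b (i , j) = if does (i ℕ.≟ a) ∧ does (j ℕ.≟ b) then c else 0ℤ

_⊕_ : Poly → Poly → Poly
(p ⊕ q) t = p t ℤ.+ q t

_⊖_ : Poly → Poly → Poly
(p ⊖ q) t = p t ℤ.- q t

mulMono : ℤ → Term → Poly → Poly
mulMono c (a , b) p (i , j) =
  if does (a ≤? i) ∧ does (b ≤? j) then c ℤ.* p (i ∸ a , j ∸ b) else 0ℤ

ΣP : ℕ → (ℕ → Poly) → Poly
ΣP zero    f = 0P
ΣP (suc N) f = ΣP N f ⊕ f N

sumℤ : ℕ → (ℕ → ℤ) → ℤ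
sumℤ zero    f = 0ℤ
sumℤ (suc N) f = sumℤ N f ℤ.+ f N

_⊗_ : Poly → Poly → Poly
(p ⊗ q) (i , j) =
  sumℤ (suc i) λ a → sumℤ (suc j) λ b → p (a , b) ℤ.* q (i ∸ a , j ∸ b)

ΣFin : (n : ℕ) → (Fin n → Poly) → Poly
ΣFin zero    f = 0P
ΣFin (suc n) f = f Fin.zero ⊕ ΣFin n (λ k → f (Fin.suc k))

IsHT : Poly → Term → Set
IsHT p t = (p t ≢ 0ℤ) × (∀ t' → t <T t' → p t' ≡ 0ℤ)

-- D-reduction.  f D-reduces to g modulo p: some monomial c·u of f
-- (c ≠ 0) equals m'·HM(p) with m' = c'·s, c' ∈ ℤ, and g = f − m'·p.

DRed1 : Poly → Poly → Poly → Set
DRed1 p f g =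
  Σ Term λ tp → IsHT p tp × 
  Σ Term λ s → Σ ℤ λ c' →
    (f (s +T tp) ≢ 0ℤ) × (f (s +T tp) ≡ c' ℤ.* p tp) ×
    (g ≈P (f ⊖ mulMono c' s p))

Step : {n : ℕ} → (Fin n → Poly) → Poly → Poly → Set
Step G f g = ∃[ i ] DRed1 (G i) f g

DRedZero : {n : ℕ} → (Fin n → Poly) → Poly → Set
DRedZero G f = ∃[ g ] (Star (Step G) f g × g ≈P 0P)

IsDNF : {n : ℕ} → (Fin n → Poly) → Poly → Poly → Set
IsDNF G f g = Star (Step G) f g × (¬ (∃[ h ] Step G g h))

InIdeal : {n : ℕ} → (Fin n → Poly) → Poly → Set
InIdeal {n} G f =
  Σ (Fin n → Poly) λ hs → ((∀ i → IsPoly (hs i)) × (f ≈P ΣFin n (λ i → hs i ⊗ G i)))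

IsDGroebner : {n : ℕ} → (Fin n → Poly) → Set
IsDGroebner G = ∀ f → InIdeal G f → ∀ g → IsDNF G f g → g ≈P 0P

IsSPoly : Poly → Poly → Poly → Set
IsSPoly g₁ g₂ h =
  Σ Term λ t₁ → Σ Term λ t₂ → IsHT g₁ t₁ × IsHT g₂ t₂ ×
  Σ ℤ λ b₁ → Σ ℤ λ b₂ →
    (b₁ ℤ.* g₁ t₁ ≡ lcm (g₁ t₁) (g₂ t₂)) ×
    (b₂ ℤ.* g₂ t₂ ≡ lcm (g₁ t₁) (g₂ t₂)) ×
    (h ≈P (mulMono b₁ (lcmT t₁ t₂ -T t₁) g₁ ⊖ mulMono b₂ (lcmT t₁ t₂ -T t₂) g₂))

mk : ℕ → ℕ
mk k = (k ∸ 1) ℕD./ 2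

C₁ : ℕ → Poly
C₁ k = ((ΣP (suc k) (λ j → mono 1ℤ 0 j) ⊕ ΣP (k ∸ 1) (λ i → mono 1ℤ (suc i) 0))
        ⊕ mono (+ mk k) 1 1) ⊖ mono (+ mk k) 0 0

C₂ : ℕ → Poly
C₂ k = ((ΣP (suc k) (λ i → mono 1ℤ i 0) ⊕ ΣP (k ∸ 1) (λ j → mono 1ℤ 0 (suc j)))
        ⊕ mono (+ mk k) 1 1) ⊖ mono (+ mk k) 0 0

C₃ : ℕ → Poly
C₃ k = ((mono 1ℤ 2 1 ⊕ mono 1ℤ 1 1) ⊖ mono 1ℤ 1 0) ⊖ mono 1ℤ 0 0

C₄ : ℕ → Poly
C₄ k = ((mono 1ℤ 1 2 ⊕ mono 1ℤ 1 1) ⊖ mono 1ℤ 0 1) ⊖ mono 1ℤ 0 0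

C₅ : ℕ → Poly
C₅ k = mono (+ (k ∸ 2)) 1 1 ⊖ mono (+ (k ∸ 2)) 0 0

C : ℕ → Fin 5 → Poly
C k Fin.zero = C₁ k
C k (Fin.suc Fin.zero) = C₂ k
C k (Fin.suc (Fin.suc Fin.zero)) = C₃ k
C k (Fin.suc (Fin.suc (Fin.suc Fin.zero))) = C₄ k
C k (Fin.suc (Fin.suc (Fin.suc (Fin.suc Fin.zero)))) = C₅ k

-- Let u = xy - 1, so that C₃ = (x + 1) u, C₄ = (y + 1) u and C₅ = (k - 2) u.
-- We use integer linear functionals x^a y^b ↦ H (a + (2k - 1) b) - β (-1)^(a+b) b,
-- where H is quasi-periodic of period 2k with drift 2β(-1)^n and sums to -β over
-- a period. Such a functional kills x^p y^q C₃, x^p y^q C₄ exactly and x^p y^q C₁,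
-- x^p y^q C₂, x^p y^q C₅ modulo β (k - 2), since the support of x^p y^q C₁ and
-- x^p y^q C₂ is, up to the xy term, a hook covering one full period. Taking β = 0
-- and H an indicator of residues gives functionals triangular at x^i and y^j
-- (i, j < k), and one functional with β = 1 is triangular at xy. Hence a nonzero
-- polynomial killed by all of them never has head x^i or y^j, and its coefficient
-- at a head xy is a multiple of k - 2; every other head term is divisible by the
-- head of some generator with coefficient 1. This class contains the ideal and the
-- S-polynomials and is closed under D-reduction, so D-reduction reaches 0 and all
-- D-normal forms of ideal elements vanish.

module Submission where

open import Defs
open import Data.Nat as ℕ using (ℕ; zero; suc; z≤n; s≤s; _⊔_)
import Data.Nat.Properties as ℕP
open import Data.Nat.DivMod using (_%_; _/_; [m+n]%n≡m%n; [m+kn]%n≡m%n; m<n⇒m%n≡m; m<n⇒m/n≡0; m/n≡1+[m∸n]/n; +-distrib-/-∣ʳ; m*n/n≡m)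
open import Data.Nat.Divisibility using (divides-refl)
open import Data.Nat.Tactic.RingSolver as ℕSolver using ()
open import Data.Integer as ℤ using (ℤ; +_; 0ℤ; 1ℤ; -_; _+_; _*_; _-_)
import Data.Integer.Properties as ℤP
open import Data.Integer.Divisibility.Signed using (_∣_; divides; 0∣⇒≡0; ∣m∣n⇒∣m+n; ∣m∣n⇒∣m-n; ∣n⇒∣m*n)
open import Data.Integer.Tactic.RingSolver using (solve-∀)
open import Data.Fin as Fin using (Fin; _<_; #_)
open import Data.Product using (Σ; ∃; ∃-syntax; _,_; _×_; proj₁; proj₂)
import Data.Product.Properties as ×P
open import Data.Sum using (_⊎_; inj₁; inj₂)
open import Data.Empty using (⊥-elim)
open import Function.Base using (_∘_)
open import Relation.Binary using (tri<; tri≈; tri>)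
open import Relation.Binary.PropositionalEquality
open import Relation.Binary.Construct.Closure.ReflexiveTransitive using (Star; ε; _◅_)
open import Relation.Nullary using (¬_; Dec; yes; no; does)
open import Relation.Nullary.Decidable using (dec-true; dec-false; _×-dec_)

sumℤ-cong : ∀ N {f g : ℕ → ℤ} → (∀ i → i ℕ.< N → f i ≡ g i) → sumℤ N f ≡ sumℤ N g
sumℤ-cong zero    f≡g = refl
sumℤ-cong (suc N) f≡g =
  cong₂ _+_ (sumℤ-cong N (λ i i<N → f≡g i (ℕP.m<n⇒m<1+n i<N))) (f≡g N ℕP.≤-refl)

sumℤ-zero : ∀ N {f : ℕ → ℤ} → (∀ i → i ℕ.< N → f i ≡ 0ℤ) → sumℤ N f ≡ 0ℤ
sumℤ-zero N f≡0 = trans (sumℤ-cong N f≡0) (zeros N)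
  where zeros : ∀ N → sumℤ N (λ _ → 0ℤ) ≡ 0ℤ
        zeros zero    = refl
        zeros (suc N) = cong (_+ 0ℤ) (zeros N)

sumℤ-+ : ∀ N (f g : ℕ → ℤ) → sumℤ N (λ i → f i + g i) ≡ sumℤ N f + sumℤ N g
sumℤ-+ zero    f g = refl
sumℤ-+ (suc N) f g = trans (cong (_+ (f N + g N)) (sumℤ-+ N f g)) (swap (sumℤ N f) (sumℤ N g) (f N) (g N))
  where swap : ∀ a b c d → a + b + (c + d) ≡ a + c + (b + d)
        swap = solve-∀

sumℤ-*ˡ : ∀ N c (f : ℕ → ℤ) → sumℤ N (λ i → c * f i) ≡ c * sumℤ N f
sumℤ-*ˡ zero    c f = sym (ℤP.*-zeroʳ c)
sumℤ-*ˡ (suc N) c f =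
  trans (cong (_+ c * f N) (sumℤ-*ˡ N c f)) (sym (ℤP.*-distribˡ-+ c (sumℤ N f) (f N)))

sumℤ-neg : ∀ N (f : ℕ → ℤ) → sumℤ N (λ i → - f i) ≡ - sumℤ N f
sumℤ-neg zero    f = refl
sumℤ-neg (suc N) f = trans (cong (_+ - f N) (sumℤ-neg N f)) (sym (ℤP.neg-distrib-+ (sumℤ N f) (f N)))

sumℤ-+* : ∀ N c (f g : ℕ → ℤ) → sumℤ N (λ i → f i + c * g i) ≡ sumℤ N f + c * sumℤ N g
sumℤ-+* N c f g = trans (sumℤ-+ N f _) (cong (λ s → sumℤ N f + s) (sumℤ-*ˡ N c g))

sumℤ-split : ∀ m n (f : ℕ → ℤ) → sumℤ (m ℕ.+ n) f ≡ sumℤ m f + sumℤ n (λ i → f (m ℕ.+ i))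
sumℤ-split m zero    f = trans (cong (λ N → sumℤ N f) (ℕP.+-identityʳ m)) (sym (ℤP.+-identityʳ _))
sumℤ-split m (suc n) f = begin
  sumℤ (m ℕ.+ suc n) f                             ≡⟨ cong (λ N → sumℤ N f) (ℕP.+-suc m n) ⟩
  sumℤ (m ℕ.+ n) f + f (m ℕ.+ n)                   ≡⟨ cong (_+ f (m ℕ.+ n)) (sumℤ-split m n f) ⟩
  sumℤ m f + sumℤ n (λ i → f (m ℕ.+ i)) + f (m ℕ.+ n) ≡⟨ ℤP.+-assoc (sumℤ m f) _ _ ⟩
  sumℤ m f + sumℤ (suc n) (λ i → f (m ℕ.+ i))      ∎
  where open ≡-Reasoning

sumℤ-suc : ∀ N (f : ℕ → ℤ) → sumℤ (suc N) f ≡ f 0 + sumℤ N (λ i → f (suc i))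
sumℤ-suc N f = trans (sumℤ-split 1 N f) (cong (_+ sumℤ N (λ i → f (suc i))) (ℤP.+-identityˡ (f 0)))

sumℤ-reverse : ∀ N (f : ℕ → ℤ) → sumℤ N f ≡ sumℤ N (λ j → f (N ℕ.∸ suc j))
sumℤ-reverse zero    f = refl
sumℤ-reverse (suc N) f = begin
  sumℤ N f + f N                              ≡⟨ cong (_+ f N) (sumℤ-reverse N f) ⟩
  sumℤ N (λ j → f (N ℕ.∸ suc j)) + f N        ≡⟨ ℤP.+-comm _ (f N) ⟩
  f N + sumℤ N (λ j → f (N ℕ.∸ suc j))        ≡⟨ sumℤ-suc N (λ j → f (suc N ℕ.∸ suc j)) ⟨
  sumℤ (suc N) (λ j → f (suc N ℕ.∸ suc j))    ∎
  where open ≡-Reasoning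

sumℤ-extend : ∀ n n' (f : ℕ → ℤ) → n ℕ.≤ n' → (∀ i → n ℕ.≤ i → i ℕ.< n' → f i ≡ 0ℤ) →
              sumℤ n' f ≡ sumℤ n f
sumℤ-extend n n' f n≤n' f≡0 with ℕP.m≤n⇒∃[o]m+o≡n n≤n'
... | e , refl = trans (sumℤ-split n e f)
  (trans (cong (λ s → sumℤ n f + s) (sumℤ-zero e (λ i i<e → f≡0 (n ℕ.+ i) (ℕP.m≤m+n n i) (ℕP.+-monoʳ-< n i<e))))
         (ℤP.+-identityʳ _))

sumℤ-single : ∀ N i₀ (f : ℕ → ℤ) → i₀ ℕ.< N → (∀ i → i ℕ.< N → i ≢ i₀ → f i ≡ 0ℤ) → sumℤ N f ≡ f i₀
sumℤ-single zero    i₀ f ()   _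
sumℤ-single (suc N) i₀ f i₀<N f≡0 with i₀ ℕ.≟ N
... | yes refl = trans (cong (_+ f i₀) (sumℤ-zero N (λ i i<N → f≡0 i (ℕP.m<n⇒m<1+n i<N) (ℕP.<⇒≢ i<N))))
                       (ℤP.+-identityˡ _)
... | no i₀≢N  = trans (cong₂ _+_ (sumℤ-single N i₀ f (ℕP.≤∧≢⇒< (ℕP.≤-pred i₀<N) i₀≢N)
                                      (λ i i<N → f≡0 i (ℕP.m<n⇒m<1+n i<N)))
                                  (f≡0 N ℕP.≤-refl (≢-sym i₀≢N)))
                       (ℤP.+-identityʳ _)

alt : ℕ → ℤ
alt zero    = 1ℤ
alt (suc n) = - alt n

alt-+ : ∀ m n → alt (m ℕ.+ n) ≡ alt m * alt n
alt-+ zero    n = sym (ℤP.*-identityˡ (alt n))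
alt-+ (suc m) n = trans (cong -_ (alt-+ m n)) (ℤP.neg-distribˡ-* (alt m) (alt n))

alt-2* : ∀ n → alt (2 ℕ.* n) ≡ 1ℤ
alt-2* zero    = refl
alt-2* (suc n) = trans (cong (λ m → - alt m) (ℕP.+-suc n (n ℕ.+ 0))) (trans (ℤP.neg-involutive _) (alt-2* n))

alt-+2* : ∀ m n → alt (m ℕ.+ 2 ℕ.* n) ≡ alt m
alt-+2* m n = trans (alt-+ m (2 ℕ.* n)) (trans (cong (alt m *_) (alt-2* n)) (ℤP.*-identityʳ (alt m)))

alt² : ∀ n → alt n * alt n ≡ 1ℤ
alt² n = trans (sym (alt-+ n n)) (trans (cong alt (cong (n ℕ.+_) (sym (ℕP.+-identityʳ n)))) (alt-2* n))

altMoment : ℕ → ℤ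
altMoment u = sumℤ u (λ j → alt j * + j)

sumℤ-alt : ∀ N → + 2 * sumℤ N alt ≡ 1ℤ - alt N
sumℤ-alt zero    = refl
sumℤ-alt (suc N) = begin
  + 2 * (sumℤ N alt + alt N)        ≡⟨ ℤP.*-distribˡ-+ (+ 2) (sumℤ N alt) (alt N) ⟩
  + 2 * sumℤ N alt + + 2 * alt N    ≡⟨ cong (_+ + 2 * alt N) (sumℤ-alt N) ⟩
  1ℤ - alt N + + 2 * alt N          ≡⟨ step (alt N) ⟩
  1ℤ - - alt N                      ∎
  where open ≡-Reasoning
        step : ∀ s → 1ℤ - s + + 2 * s ≡ 1ℤ - - s
        step = solve-∀

sumℤ-alt-parity : ∀ u v w → u ℕ.+ v ≡ 2 ℕ.* w → sumℤ u alt ≡ sumℤ v alt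
sumℤ-alt-parity u v w u+v≡2w = ℤP.*-cancelˡ-≡ (+ 2) _ _ (begin
  + 2 * sumℤ u alt  ≡⟨ sumℤ-alt u ⟩
  1ℤ - alt u        ≡⟨ cong (λ s → 1ℤ - s) alt-u≡alt-v ⟩
  1ℤ - alt v        ≡⟨ sumℤ-alt v ⟨
  + 2 * sumℤ v alt  ∎)
  where
  open ≡-Reasoning
  alt-u≡alt-v : alt u ≡ alt v
  alt-u≡alt-v = begin
    alt u                   ≡⟨ ℤP.*-identityʳ (alt u) ⟨
    alt u * 1ℤ              ≡⟨ cong (alt u *_) (trans (cong alt u+v≡2w) (alt-2* w)) ⟨
    alt u * alt (u ℕ.+ v)   ≡⟨ cong (alt u *_) (alt-+ u v) ⟩
    alt u * (alt u * alt v) ≡⟨ ℤP.*-assoc (alt u) (alt u) (alt v) ⟨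
    alt u * alt u * alt v   ≡⟨ cong (_* alt v) (alt² u) ⟩
    1ℤ * alt v              ≡⟨ ℤP.*-identityˡ (alt v) ⟩
    alt v                   ∎

-- The term order, via its order isomorphism rank with ℕ

deg : Term → ℕ
deg (a , b) = a ℕ.+ b

-- tri d is the number of terms of degree < d.
tri : ℕ → ℕ
tri zero    = 0
tri (suc d) = tri d ℕ.+ suc d

rank : Term → ℕ
rank (a , b) = tri (a ℕ.+ b) ℕ.+ a

tri-mono : ∀ {d d'} → d ℕ.≤ d' → tri d ℕ.≤ tri d'
tri-mono {d} {d'} d≤d' with ℕP.m≤n⇒∃[o]m+o≡n d≤d'
... | e , refl = go e
  where go : ∀ e → tri d ℕ.≤ tri (d ℕ.+ e)
        go zero    = ℕP.≤-reflexive (cong tri (sym (ℕP.+-identityʳ d)))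
        go (suc e) = ℕP.≤-trans (go e) (ℕP.≤-trans (ℕP.m≤m+n _ _) (ℕP.≤-reflexive (cong tri (sym (ℕP.+-suc d e)))))

rank-<-tri : ∀ t → rank t ℕ.< tri (suc (deg t))
rank-<-tri (a , b) = ℕP.+-monoʳ-< (tri (a ℕ.+ b)) (s≤s (ℕP.m≤m+n a b))

rank-mono : ∀ {t t'} → t <T t' → rank t ℕ.< rank t'
rank-mono {t} {t'} (inj₁ deg<) =
  ℕP.<-≤-trans (rank-<-tri t) (ℕP.≤-trans (tri-mono deg<) (ℕP.m≤m+n _ (proj₁ t')))
rank-mono {a , b} {c , d} (inj₂ (deg≡ , a<c)) rewrite deg≡ = ℕP.+-monoʳ-< (tri (c ℕ.+ d)) a<c

<T-trichotomy : ∀ t t' → t ≢ t' → t <T t' ⊎ t' <T t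
<T-trichotomy (a , b) (c , d) t≢t' with ℕP.<-cmp (a ℕ.+ b) (c ℕ.+ d)
... | tri< deg< _ _ = inj₁ (inj₁ deg<)
... | tri> _ _ deg> = inj₂ (inj₁ deg>)
... | tri≈ _ deg≡ _ with ℕP.<-cmp a c
...   | tri< a<c _ _ = inj₁ (inj₂ (deg≡ , a<c))
...   | tri> _ _ a>c = inj₂ (inj₂ (sym deg≡ , a>c))
...   | tri≈ _ refl _ = ⊥-elim (t≢t' (cong (a ,_) (ℕP.+-cancelˡ-≡ a b d deg≡)))

rank-injective : ∀ {t t'} → rank t ≡ rank t' → t ≡ t'
rank-injective {t} {t'} eq with ×P.≡-dec ℕP._≟_ ℕP._≟_ t t'
... | yes t≡t' = t≡t'
... | no  t≢t' with <T-trichotomy t t' t≢t'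
...   | inj₁ lt = ⊥-elim (ℕP.<⇒≢ (rank-mono lt) eq)
...   | inj₂ gt = ⊥-elim (ℕP.<⇒≢ (rank-mono gt) (sym eq))

rank-reflects : ∀ {t t'} → rank t ℕ.< rank t' → t <T t'
rank-reflects {t} {t'} lt with ×P.≡-dec ℕP._≟_ ℕP._≟_ t t'
... | yes refl = ⊥-elim (ℕP.<-irrefl refl lt)
... | no  t≢t' with <T-trichotomy t t' t≢t'
...   | inj₁ t<t' = t<t'
...   | inj₂ t'<t = ⊥-elim (ℕP.<-asym lt (rank-mono t'<t))

<T-trans : ∀ {t t' t''} → t <T t' → t' <T t'' → t <T t''
<T-trans l₁ l₂ = rank-reflects (ℕP.<-trans (rank-mono l₁) (rank-mono l₂))

<T-irrefl : ∀ {t t'} → t <T t' → t ≢ t'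
<T-irrefl l refl = ℕP.<-irrefl refl (rank-mono l)

next : Term → Term
next (a , zero)  = (0 , suc a)
next (a , suc b) = (suc a , b)

rank-next : ∀ t → rank (next t) ≡ suc (rank t)
rank-next (a , zero)  rewrite ℕP.+-identityʳ a | ℕP.+-identityʳ (tri a ℕ.+ suc a) = ℕP.+-suc (tri a) a
rank-next (a , suc b) rewrite ℕP.+-suc a b = ℕP.+-suc (tri (suc (a ℕ.+ b))) a

unrank : ℕ → Term
unrank zero    = (0 , 0)
unrank (suc n) = next (unrank n)

rank-unrank : ∀ n → rank (unrank n) ≡ n
rank-unrank zero    = refl
rank-unrank (suc n) = trans (rank-next (unrank n)) (cong suc (rank-unrank n))

unrank-rank : ∀ t → unrank (rank t) ≡ t
unrank-rank t = rank-injective (rank-unrank (rank t))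

+T-monoʳ-<T : ∀ s {t t'} → t <T t' → (s +T t) <T (s +T t')
+T-monoʳ-<T (p , q) {a , b} {c , d} (inj₁ deg<) =
  inj₁ (subst₂ ℕ._<_ (reorder p q a b) (reorder p q c d) (ℕP.+-monoʳ-< (p ℕ.+ q) deg<))
  where reorder : ∀ p q a b → p ℕ.+ q ℕ.+ (a ℕ.+ b) ≡ p ℕ.+ a ℕ.+ (q ℕ.+ b)
        reorder = ℕSolver.solve-∀
+T-monoʳ-<T (p , q) {a , b} {c , d} (inj₂ (deg≡ , a<c)) =
  inj₂ (trans (sym (reorder p q a b)) (trans (cong (p ℕ.+ q ℕ.+_) deg≡) (reorder p q c d)) , ℕP.+-monoʳ-< p a<c)
  where reorder : ∀ p q a b → p ℕ.+ q ℕ.+ (a ℕ.+ b) ≡ p ℕ.+ a ℕ.+ (q ℕ.+ b)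
        reorder = ℕSolver.solve-∀

_≤C_ : Term → Term → Set
(p , q) ≤C (a , b) = (p ℕ.≤ a) × (q ℕ.≤ b)

+T-∸T : ∀ {s t} → s ≤C t → s +T (t -T s) ≡ t
+T-∸T (p≤a , q≤b) = cong₂ _,_ (ℕP.m+[n∸m]≡n p≤a) (ℕP.m+[n∸m]≡n q≤b)

<T-∸T : ∀ s tp t → s ≤C t → (s +T tp) <T t → tp <T (t -T s)
<T-∸T s tp t s≤t lt with <T-trichotomy tp (t -T s) (λ eq → <T-irrefl lt (trans (cong (s +T_) eq) (+T-∸T s≤t)))
... | inj₁ tp<t-s = tp<t-s
... | inj₂ t-s<tp = ⊥-elim (<T-irrefl (<T-trans lt (subst (_<T (s +T tp)) (+T-∸T s≤t) (+T-monoʳ-<T s t-s<tp))) refl)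

_≤C?_ : ∀ s t → Dec (s ≤C t)
(p , q) ≤C? (a , b) = (p ℕ.≤? a) ×-dec (q ℕ.≤? b)

ΣP-apply : ∀ N (f : ℕ → Poly) t → ΣP N f t ≡ sumℤ N (λ j → f j t)
ΣP-apply zero    f t = refl
ΣP-apply (suc N) f t = cong (_+ f N t) (ΣP-apply N f t)

mono-at : ∀ c a b → mono c a b (a , b) ≡ c
mono-at c a b rewrite dec-true (a ℕ.≟ a) refl | dec-true (b ℕ.≟ b) refl = refl

mono-≢ : ∀ c a b t → t ≢ (a , b) → mono c a b t ≡ 0ℤ
mono-≢ c a b (i , j) t≢ab with i ℕ.≟ a
... | no i≢a rewrite dec-false (i ℕ.≟ a) i≢a = refl
... | yes refl with j ℕ.≟ b
...   | no j≢b rewrite dec-true (i ℕ.≟ i) refl | dec-false (j ℕ.≟ b) j≢b = refl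
...   | yes refl = ⊥-elim (t≢ab refl)

mulMono-≤C : ∀ c s P t → s ≤C t → mulMono c s P t ≡ c * P (t -T s)
mulMono-≤C c (p , q) P (a , b) (p≤a , q≤b) rewrite dec-true (p ℕ.≤? a) p≤a | dec-true (q ℕ.≤? b) q≤b = refl

mulMono-≰C : ∀ c s P t → ¬ (s ≤C t) → mulMono c s P t ≡ 0ℤ
mulMono-≰C c (p , q) P (a , b) s≰t with p ℕ.≤? a
... | no p≰a rewrite dec-false (p ℕ.≤? a) p≰a = refl
... | yes p≤a with q ℕ.≤? b
...   | no q≰b rewrite dec-true (p ℕ.≤? a) p≤a | dec-false (q ℕ.≤? b) q≰b = refl
...   | yes q≤b = ⊥-elim (s≰t (p≤a , q≤b))

mulMono-+T : ∀ c s P t → mulMono c s P (s +T t) ≡ c * P t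
mulMono-+T c (p , q) P (a , b) =
  trans (mulMono-≤C c (p , q) P (p ℕ.+ a , q ℕ.+ b) (ℕP.m≤m+n p a , ℕP.m≤m+n q b))
        (cong (λ t → c * P t) (cong₂ _,_ (ℕP.m+n∸m≡n p a) (ℕP.m+n∸m≡n q b)))

Deg≤ : ℕ → Poly → Set
Deg≤ d g = ∀ t → d ℕ.< deg t → g t ≡ 0ℤ

Deg≤-mono : ∀ {d d' g} → d ℕ.≤ d' → Deg≤ d g → Deg≤ d' g
Deg≤-mono d≤d' g≤d t d'<t = g≤d t (ℕP.≤-<-trans d≤d' d'<t)

Deg≤-⊖ : ∀ {d d' g g'} → Deg≤ d g → Deg≤ d' g' → Deg≤ (d ⊔ d') (g ⊖ g')
Deg≤-⊖ {d} {d'} g≤d g'≤d' t lt =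
  cong₂ _-_ (Deg≤-mono (ℕP.m≤m⊔n d d') g≤d t lt) (Deg≤-mono (ℕP.m≤n⊔m d d') g'≤d' t lt)

Deg≤-⊕ : ∀ {d d' g g'} → Deg≤ d g → Deg≤ d' g' → Deg≤ (d ⊔ d') (g ⊕ g')
Deg≤-⊕ {d} {d'} g≤d g'≤d' t lt =
  cong₂ _+_ (Deg≤-mono (ℕP.m≤m⊔n d d') g≤d t lt) (Deg≤-mono (ℕP.m≤n⊔m d d') g'≤d' t lt)

Deg≤-mulMono : ∀ {d P} c p q → Deg≤ d P → Deg≤ (p ℕ.+ q ℕ.+ d) (mulMono c (p , q) P)
Deg≤-mulMono {d} {P} c p q P≤d (a , b) lt with p ℕ.≤? a | q ℕ.≤? b
... | no p≰a | _      = mulMono-≰C c (p , q) P (a , b) (λ le → p≰a (proj₁ le))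
... | yes _  | no q≰b = mulMono-≰C c (p , q) P (a , b) (λ le → q≰b (proj₂ le))
... | yes p≤a | yes q≤b with ℕP.m≤n⇒∃[o]m+o≡n p≤a | ℕP.m≤n⇒∃[o]m+o≡n q≤b
...   | a' , refl | b' , refl =
  trans (mulMono-+T c (p , q) P (a' , b'))
        (trans (cong (c *_) (P≤d (a' , b') (ℕP.+-cancelˡ-< (p ℕ.+ q) d (a' ℕ.+ b') (subst (p ℕ.+ q ℕ.+ d ℕ.<_) (reorder p q a' b') lt))))
               (ℤP.*-zeroʳ c))
  where reorder : ∀ p q a b → p ℕ.+ a ℕ.+ (q ℕ.+ b) ≡ p ℕ.+ q ℕ.+ (a ℕ.+ b)
        reorder = ℕSolver.solve-∀

sum² : ℕ → ℕ → (ℕ → ℕ → ℤ) → ℤ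
sum² N M F = sumℤ N (λ a → sumℤ M (λ b → F a b))

sum²-cong : ∀ N M {F G : ℕ → ℕ → ℤ} → (∀ a b → F a b ≡ G a b) → sum² N M F ≡ sum² N M G
sum²-cong N M F≡G = sumℤ-cong N (λ a _ → sumℤ-cong M (λ b _ → F≡G a b))

sum²-zero : ∀ N M {F : ℕ → ℕ → ℤ} → (∀ a b → F a b ≡ 0ℤ) → sum² N M F ≡ 0ℤ
sum²-zero N M F≡0 = sumℤ-zero N (λ a _ → sumℤ-zero M (λ b _ → F≡0 a b))

sum²-+ : ∀ N M (F G : ℕ → ℕ → ℤ) → sum² N M (λ a b → F a b + G a b) ≡ sum² N M F + sum² N M G
sum²-+ N M F G = trans (sumℤ-cong N (λ a _ → sumℤ-+ M (F a) (G a))) (sumℤ-+ N _ _)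

sum²-*ˡ : ∀ N M c (F : ℕ → ℕ → ℤ) → sum² N M (λ a b → c * F a b) ≡ c * sum² N M F
sum²-*ˡ N M c F = trans (sumℤ-cong N (λ a _ → sumℤ-*ˡ M c (F a))) (sumℤ-*ˡ N c _)

sum²-neg : ∀ N M (F : ℕ → ℕ → ℤ) → sum² N M (λ a b → - F a b) ≡ - sum² N M F
sum²-neg N M F = trans (sumℤ-cong N (λ a _ → sumℤ-neg M (F a))) (sumℤ-neg N _)

sum²-single : ∀ N M a₀ b₀ (F : ℕ → ℕ → ℤ) → a₀ ℕ.< N → b₀ ℕ.< M →
              (∀ a b → (a , b) ≢ (a₀ , b₀) → F a b ≡ 0ℤ) → sum² N M F ≡ F a₀ b₀
sum²-single N M a₀ b₀ F a₀<N b₀<M F≡0 =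
  trans (sumℤ-single N a₀ _ a₀<N (λ a _ a≢a₀ → sumℤ-zero M (λ b _ → F≡0 a b (λ eq → a≢a₀ (cong proj₁ eq)))))
        (sumℤ-single M b₀ _ b₀<M (λ b _ b≢b₀ → F≡0 a₀ b (λ eq → b≢b₀ (cong proj₂ eq))))

sum²-extend : ∀ n m n' m' (F : ℕ → ℕ → ℤ) → n ℕ.≤ n' → m ℕ.≤ m' →
              (∀ a b → n ℕ.≤ a ⊎ m ℕ.≤ b → F a b ≡ 0ℤ) → sum² n' m' F ≡ sum² n m F
sum²-extend n m n' m' F n≤n' m≤m' F≡0 =
  trans (sumℤ-extend n n' _ n≤n' (λ a n≤a _ → sumℤ-zero m' (λ b _ → F≡0 a b (inj₁ n≤a))))
        (sumℤ-cong n (λ a _ → sumℤ-extend m m' (F a) m≤m' (λ b m≤b _ → F≡0 a b (inj₂ m≤b))))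

sum²-shift : ∀ p q N M (F : ℕ → ℕ → ℤ) → (∀ a b → ¬ (p ℕ.≤ a × q ℕ.≤ b) → F a b ≡ 0ℤ) →
             sum² (p ℕ.+ N) (q ℕ.+ M) F ≡ sum² N M (λ a b → F (p ℕ.+ a) (q ℕ.+ b))
sum²-shift p q N M F F≡0 = begin
  sumℤ (p ℕ.+ N) (λ a → sumℤ (q ℕ.+ M) (F a))
    ≡⟨ sumℤ-split p N _ ⟩
  sumℤ p (λ a → sumℤ (q ℕ.+ M) (F a)) + sumℤ N (λ a → sumℤ (q ℕ.+ M) (F (p ℕ.+ a)))
    ≡⟨ cong₂ _+_ (sumℤ-zero p (λ a a<p → sumℤ-zero (q ℕ.+ M) (λ b _ → F≡0 a b (λ le → ℕP.<⇒≱ a<p (proj₁ le)))))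
                 (sumℤ-cong N (λ a _ → inner a)) ⟩
  0ℤ + sum² N M (λ a b → F (p ℕ.+ a) (q ℕ.+ b))
    ≡⟨ ℤP.+-identityˡ _ ⟩
  sum² N M (λ a b → F (p ℕ.+ a) (q ℕ.+ b)) ∎
  where
  open ≡-Reasoning
  inner : ∀ a → sumℤ (q ℕ.+ M) (F (p ℕ.+ a)) ≡ sumℤ M (λ b → F (p ℕ.+ a) (q ℕ.+ b))
  inner a = trans (sumℤ-split q M _)
    (trans (cong (_+ sumℤ M (λ b → F (p ℕ.+ a) (q ℕ.+ b)))
                 (sumℤ-zero q (λ b b<q → F≡0 (p ℕ.+ a) b (λ le → ℕP.<⇒≱ b<q (proj₂ le)))))
           (ℤP.+-identityˡ _))

pairing : ℕ → ℕ → Poly → (ℕ → ℕ → ℤ) → ℤ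
pairing N M g L = sum² N M (λ a b → g (a , b) * L a b)

pairing-cong : ∀ N M {g g'} L → g ≈P g' → pairing N M g L ≡ pairing N M g' L
pairing-cong N M L g≈g' = sum²-cong N M (λ a b → cong (_* L a b) (g≈g' (a , b)))

pairing-⊕ : ∀ N M g g' L → pairing N M (g ⊕ g') L ≡ pairing N M g L + pairing N M g' L
pairing-⊕ N M g g' L =
  trans (sum²-cong N M (λ a b → ℤP.*-distribʳ-+ (L a b) (g (a , b)) (g' (a , b)))) (sum²-+ N M _ _)

pairing-⊖ : ∀ N M g g' L → pairing N M (g ⊖ g') L ≡ pairing N M g L - pairing N M g' L
pairing-⊖ N M g g' L =
  trans (sum²-cong N M (λ a b → distrib (g (a , b)) (g' (a , b)) (L a b)))
        (trans (sum²-+ N M _ _) (cong (λ s → pairing N M g L + s) (sum²-neg N M _)))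
  where distrib : ∀ x y l → (x - y) * l ≡ x * l + - (y * l)
        distrib = solve-∀

pairing-ΣP : ∀ N M K (f : ℕ → Poly) L → pairing N M (ΣP K f) L ≡ sumℤ K (λ j → pairing N M (f j) L)
pairing-ΣP N M zero    f L = sum²-zero N M (λ a b → refl)
pairing-ΣP N M (suc K) f L =
  trans (pairing-⊕ N M (ΣP K f) (f K) L) (cong (_+ pairing N M (f K) L) (pairing-ΣP N M K f L))

pairing-mono : ∀ N M c a b L → a ℕ.< N → b ℕ.< M → pairing N M (mono c a b) L ≡ c * L a b
pairing-mono N M c a b L a<N b<M =
  trans (sum²-single N M a b _ a<N b<M (λ a' b' ne → cong (_* L a' b') (mono-≢ c a b (a' , b') ne)))
        (cong (_* L a b) (mono-at c a b))

Deg≤-bound : ∀ {d g a b} → Deg≤ d g → g (a , b) ≢ 0ℤ → a ℕ.≤ d × b ℕ.≤ d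
Deg≤-bound {d} {g} {a} {b} g≤d gab≢0 with ℕP.≤-<-connex (a ℕ.+ b) d
... | inj₁ a+b≤d = ℕP.≤-trans (ℕP.m≤m+n a b) a+b≤d , ℕP.≤-trans (ℕP.m≤n+m b a) a+b≤d
... | inj₂ d<a+b = ⊥-elim (gab≢0 (g≤d (a , b) d<a+b))

pairing-Deg≤ : ∀ {d g} N M L → Deg≤ d g → d ℕ.< N → d ℕ.< M →
               pairing N M g L ≡ pairing (suc d) (suc d) g L
pairing-Deg≤ {d} {g} N M L g≤d d<N d<M = sum²-extend (suc d) (suc d) N M _ d<N d<M vanish
  where vanish : ∀ a b → suc d ℕ.≤ a ⊎ suc d ℕ.≤ b → g (a , b) * L a b ≡ 0ℤ
        vanish a b (inj₁ d<a) = trans (cong (_* L a b) (g≤d (a , b) (ℕP.≤-trans d<a (ℕP.m≤m+n a b)))) refl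
        vanish a b (inj₂ d<b) = trans (cong (_* L a b) (g≤d (a , b) (ℕP.≤-trans d<b (ℕP.m≤n+m b a)))) refl

shift : ℕ → ℕ → (ℕ → ℕ → ℤ) → ℕ → ℕ → ℤ
shift p q L a b = L (p ℕ.+ a) (q ℕ.+ b)

hook : ℕ → ℕ → (ℕ → ℕ → ℤ) → ℤ
hook u v F = sumℤ u (λ j → F 0 j) + sumℤ v (λ i → F (suc i) 0)

pairing-mulMono : ∀ {e P} c p q L → Deg≤ e P →
  pairing (suc (p ℕ.+ q ℕ.+ e)) (suc (p ℕ.+ q ℕ.+ e)) (mulMono c (p , q) P) L ≡
  c * pairing (suc e) (suc e) P (shift p q L)
pairing-mulMono {e} {P} c p q L P≤e = begin
  sum² (suc (p ℕ.+ q ℕ.+ e)) (suc (p ℕ.+ q ℕ.+ e)) F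
    ≡⟨ cong₂ (λ N M → sum² N M F) (box p q e) (trans (cong (λ n → suc (n ℕ.+ e)) (ℕP.+-comm p q)) (box q p e)) ⟩
  sum² (p ℕ.+ suc (q ℕ.+ e)) (q ℕ.+ suc (p ℕ.+ e)) F
    ≡⟨ sum²-shift p q (suc (q ℕ.+ e)) (suc (p ℕ.+ e)) F (λ a b s≰t → cong (_* L a b) (mulMono-≰C c (p , q) P (a , b) s≰t)) ⟩
  sum² (suc (q ℕ.+ e)) (suc (p ℕ.+ e)) (λ a b → F (p ℕ.+ a) (q ℕ.+ b))
    ≡⟨ sum²-cong (suc (q ℕ.+ e)) (suc (p ℕ.+ e)) (λ a b → trans (cong (_* L (p ℕ.+ a) (q ℕ.+ b)) (mulMono-+T c (p , q) P (a , b)))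
                                     (ℤP.*-assoc c (P (a , b)) _)) ⟩
  sum² (suc (q ℕ.+ e)) (suc (p ℕ.+ e)) (λ a b → c * (P (a , b) * shift p q L a b))
    ≡⟨ sum²-*ˡ (suc (q ℕ.+ e)) (suc (p ℕ.+ e)) c _ ⟩
  c * pairing (suc (q ℕ.+ e)) (suc (p ℕ.+ e)) P (shift p q L)
    ≡⟨ cong (c *_) (pairing-Deg≤ _ _ (shift p q L) P≤e (s≤s (ℕP.m≤n+m e q)) (s≤s (ℕP.m≤n+m e p))) ⟩
  c * pairing (suc e) (suc e) P (shift p q L) ∎
  where
  open ≡-Reasoning
  F = λ a b → mulMono c (p , q) P (a , b) * L a b
  box : ∀ p q e → suc (p ℕ.+ q ℕ.+ e) ≡ p ℕ.+ suc (q ℕ.+ e)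
  box = ℕSolver.solve-∀

pairing-head : ∀ {d g a b} L → Deg≤ d g → g (a , b) ≢ 0ℤ →
  (∀ t → (a , b) <T t → g t ≡ 0ℤ) → (∀ a' b' → (a' , b') <T (a , b) → L a' b' ≡ 0ℤ) →
  pairing (suc d) (suc d) g L ≡ g (a , b) * L a b
pairing-head {d} {g} {a} {b} L g≤d gab≢0 g-above L-below =
  sum²-single (suc d) (suc d) a b _ (s≤s a≤d) (s≤s b≤d) vanish
  where
  a≤d = proj₁ (Deg≤-bound g≤d gab≢0)
  b≤d = proj₂ (Deg≤-bound g≤d gab≢0)
  vanish : ∀ a' b' → (a' , b') ≢ (a , b) → g (a' , b') * L a' b' ≡ 0ℤ
  vanish a' b' ne with <T-trichotomy (a' , b') (a , b) ne
  ... | inj₁ below = trans (cong (g (a' , b') *_) (L-below a' b' below)) (ℤP.*-zeroʳ (g (a' , b')))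
  ... | inj₂ above = cong (_* L a' b') (g-above (a' , b') above)

⊗-as-ΣP : ∀ {d h} P → Deg≤ d h →
  (h ⊗ P) ≈P ΣP (suc d) (λ a → ΣP (suc d) (λ b → mulMono (h (a , b)) (a , b) P))
⊗-as-ΣP {d} {h} P h≤d (x , y) = begin
  sum² (suc x) (suc y) (λ a b → h (a , b) * P (x ℕ.∸ a , y ℕ.∸ b))
    ≡⟨ sumℤ-cong (suc x) (λ a a≤x → sumℤ-cong (suc y) (λ b b≤y →
         sym (mulMono-≤C (h (a , b)) (a , b) P (x , y) (ℕP.≤-pred a≤x , ℕP.≤-pred b≤y)))) ⟩
  sum² (suc x) (suc y) G
    ≡⟨ sum²-extend (suc x) (suc y) (suc x ℕ.+ N) (suc y ℕ.+ N) G (ℕP.m≤m+n _ N) (ℕP.m≤m+n _ N) outside-xy ⟨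
  sum² (suc x ℕ.+ N) (suc y ℕ.+ N) G
    ≡⟨ sum²-extend N N (suc x ℕ.+ N) (suc y ℕ.+ N) G (ℕP.m≤n+m N (suc x)) (ℕP.m≤n+m N (suc y)) outside-h ⟩
  sum² N N G
    ≡⟨ trans (ΣP-apply N _ (x , y)) (sumℤ-cong N (λ a _ → ΣP-apply N _ (x , y))) ⟨
  ΣP N (λ a → ΣP N (λ b → mulMono (h (a , b)) (a , b) P)) (x , y) ∎
  where
  open ≡-Reasoning
  N = suc d
  G = λ a b → mulMono (h (a , b)) (a , b) P (x , y)
  outside-xy : ∀ a b → suc x ℕ.≤ a ⊎ suc y ℕ.≤ b → G a b ≡ 0ℤ
  outside-xy a b (inj₁ x<a) = mulMono-≰C (h (a , b)) (a , b) P (x , y) (λ le → ℕP.<⇒≱ x<a (proj₁ le))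
  outside-xy a b (inj₂ y<b) = mulMono-≰C (h (a , b)) (a , b) P (x , y) (λ le → ℕP.<⇒≱ y<b (proj₂ le))
  h-outside : ∀ a b → N ℕ.≤ a ⊎ N ℕ.≤ b → h (a , b) ≡ 0ℤ
  h-outside a b (inj₁ d<a) = h≤d (a , b) (ℕP.≤-trans d<a (ℕP.m≤m+n a b))
  h-outside a b (inj₂ d<b) = h≤d (a , b) (ℕP.≤-trans d<b (ℕP.m≤n+m b a))
  outside-h : ∀ a b → N ℕ.≤ a ⊎ N ℕ.≤ b → G a b ≡ 0ℤ
  outside-h a b out with (a , b) ≤C? (x , y)
  ... | yes le = trans (mulMono-≤C (h (a , b)) (a , b) P (x , y) le)
                       (trans (cong (_* P ((x , y) -T (a , b))) (h-outside a b out)) refl)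
  ... | no ¬le = mulMono-≰C (h (a , b)) (a , b) P (x , y) ¬le

-- Reduction modulo a family with known head terms

module Reduction {n : ℕ} (G : Fin n → Poly) (head : Fin n → Term) (G-head : ∀ i → IsHT (G i) (head i)) where

  HeadReducible : Poly → Term → Set
  HeadReducible g t = Σ (Fin n) λ i → Σ Term λ s → Σ ℤ λ c →
                      (s +T head i ≡ t) × (g t ≡ c * G i (head i))

  reduct : ∀ g {t} → HeadReducible g t → Poly
  reduct g (i , s , c , _) = g ⊖ mulMono c s (G i)

  reduction-step : ∀ g {t} → g t ≢ 0ℤ → (r : HeadReducible g t) → Step G g (reduct g r)
  reduction-step g gt≢0 (i , s , c , s+h≡t , gt≡) =
    i , head i , G-head i , s , c , (λ eq → gt≢0 (trans (cong g (sym s+h≡t)) eq)) ,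
    trans (cong g s+h≡t) gt≡ , (λ _ → refl)

  Above : ℕ → Poly → Set
  Above m g = ∀ t → m ℕ.≤ rank t → g t ≡ 0ℤ

  Deg≤⇒Above : ∀ {d g} → Deg≤ d g → Above (tri (suc d)) g
  Deg≤⇒Above {d} g≤d t tri≤rank = g≤d t (ℕP.≰⇒> λ deg≤d →
    ℕP.<⇒≱ (ℕP.<-≤-trans (rank-<-tri t) (tri-mono (s≤s deg≤d))) tri≤rank)

  Above-head : ∀ {m g} → Above (suc m) g → ∀ t' → unrank m <T t' → g t' ≡ 0ℤ
  Above-head {m} above t' lt = above t' (subst (ℕ._< rank t') (rank-unrank m) (rank-mono lt))

  Above-zero : ∀ {m g} → Above (suc m) g → g (unrank m) ≡ 0ℤ → Above m g
  Above-zero {m} {g} above gm≡0 t m≤t with ℕP.m≤n⇒m<n∨m≡n m≤t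
  ... | inj₁ m<t = above t m<t
  ... | inj₂ refl = trans (cong g (sym (unrank-rank t))) gm≡0

  -- Subtracting the reducing multiple cancels the head and creates nothing above it.
  Above-reduct : ∀ {m g} → Above (suc m) g → (r : HeadReducible g (unrank m)) → Above m (reduct g r)
  Above-reduct {m} {g} above (i , s , c , s+h≡t , gt≡) t m≤t with ℕP.m≤n⇒m<n∨m≡n m≤t
  ... | inj₂ m≡t = begin
    g t - mulMono c s (G i) t
      ≡⟨ cong (λ t → g t - mulMono c s (G i) t) t≡s+h ⟩
    g (s +T head i) - mulMono c s (G i) (s +T head i)
      ≡⟨ cong₂ _-_ (trans (cong g s+h≡t) gt≡) (mulMono-+T c s (G i) (head i)) ⟩
    c * G i (head i) - c * G i (head i)
      ≡⟨ ℤP.+-inverseʳ (c * G i (head i)) ⟩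
    0ℤ ∎
    where open ≡-Reasoning
          t≡s+h : t ≡ s +T head i
          t≡s+h = trans (sym (unrank-rank t)) (trans (cong unrank (sym m≡t)) (sym s+h≡t))
  ... | inj₁ m<t = trans (cong₂ _-_ (above t m<t) multiple-vanishes) refl
    where
    s+h<t : (s +T head i) <T t
    s+h<t = rank-reflects (subst (ℕ._< rank t) (trans (sym (rank-unrank m)) (cong rank (sym s+h≡t))) m<t)
    multiple-vanishes : mulMono c s (G i) t ≡ 0ℤ
    multiple-vanishes with s ≤C? t
    ... | yes s≤t = trans (mulMono-≤C c s (G i) t s≤t)
                          (trans (cong (c *_) (proj₂ (G-head i) (t -T s) (<T-∸T s (head i) t s≤t s+h<t)))
                                 (ℤP.*-zeroʳ c))
    ... | no s≰t = mulMono-≰C c s (G i) t s≰t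

  module Completeness (Good : Poly → Set) (Good-Deg≤ : ∀ {g} → Good g → ∃[ d ] Deg≤ d g)
           (Good-step : ∀ {f g} → Step G f g → Good f → Good g)
           (head-reducible : ∀ {g t} → Good g → g t ≢ 0ℤ → (∀ t' → t <T t' → g t' ≡ 0ℤ) →
                             HeadReducible g t) where

    reduce : ∀ m g → Good g → Above m g → DRedZero G g
    reduce zero    g good above = g , ε , (λ t → above t z≤n)
    reduce (suc m) g good above with g (unrank m) ℤ.≟ 0ℤ
    ... | yes gm≡0 = reduce m g good (Above-zero above gm≡0)
    ... | no  gm≢0 = prepend (reduce m (reduct g r) (Good-step step good) (Above-reduct above r))
      where
      r    = head-reducible good gm≢0 (Above-head above)
      step = reduction-step g gm≢0 r
      prepend : DRedZero G (reduct g r) → DRedZero G g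
      prepend (g' , steps , g'≈0) = g' , step ◅ steps , g'≈0

    reduces-to-zero : ∀ g → Good g → DRedZero G g
    reduces-to-zero g good = reduce _ g good (Deg≤⇒Above (proj₂ (Good-Deg≤ good)))

    normal-form-zero : ∀ {g} → Good g → ¬ (∃[ g' ] Step G g g') → g ≈P 0P
    normal-form-zero {g} good irreducible t = lower (tri (suc d)) 0 (Deg≤⇒Above g≤d) t z≤n
      where
      d   = proj₁ (Good-Deg≤ good)
      g≤d = proj₂ (Good-Deg≤ good)
      lower₁ : ∀ m → Above (suc m) g → Above m g
      lower₁ m above with g (unrank m) ℤ.≟ 0ℤ
      ... | yes gm≡0 = Above-zero above gm≡0
      ... | no  gm≢0 = ⊥-elim (irreducible (_ , reduction-step g gm≢0 (head-reducible good gm≢0 (Above-head above))))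
      lower : ∀ e m → Above (m ℕ.+ e) g → Above m g
      lower zero    m above = subst (λ m → Above m g) (ℕP.+-identityʳ m) above
      lower (suc e) m above = lower₁ m (lower e (suc m) (subst (λ m → Above m g) (ℕP.+-suc m e) above))

    Good-steps : ∀ {f g} → Star (Step G) f g → Good f → Good g
    Good-steps ε             good = good
    Good-steps (step ◅ steps) good = Good-steps steps (Good-step step good)

even-or-odd : ∀ n → ∃[ h ] (n ≡ 2 ℕ.* h ⊎ n ≡ suc (2 ℕ.* h))
even-or-odd zero    = 0 , inj₁ refl
even-or-odd (suc n) with even-or-odd n
... | h , inj₁ refl = h , inj₂ refl
... | h , inj₂ refl = suc h , inj₁ (eq h)
  where eq : ∀ h → suc (suc (2 ℕ.* h)) ≡ 2 ℕ.* suc h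
        eq = ℕSolver.solve-∀

alt-odd : ∀ h → alt (suc (2 ℕ.* h)) ≡ - 1ℤ
alt-odd h = cong -_ (alt-2* h)

altMoment-even-odd : ∀ h → altMoment (2 ℕ.* h) ≡ - + h × altMoment (suc (2 ℕ.* h)) ≡ + h
altMoment-even-odd zero    = refl , refl
altMoment-even-odd (suc h) = even , odd
  where
  open ≡-Reasoning
  n = 2 ℕ.* h
  2+n≡2*[1+h] : suc (suc n) ≡ 2 ℕ.* suc h
  2+n≡2*[1+h] = eq h where eq : ∀ h → suc (suc (2 ℕ.* h)) ≡ 2 ℕ.* suc h
                           eq = ℕSolver.solve-∀
  even′ : altMoment (suc (suc n)) ≡ - + suc h
  even′ = begin
    altMoment (suc n) + alt (suc n) * + suc n
      ≡⟨ cong₂ (λ m s → m + s * + suc n) (proj₂ (altMoment-even-odd h)) (alt-odd h) ⟩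
    + h + - 1ℤ * (1ℤ + + (h ℕ.+ (h ℕ.+ 0)))
      ≡⟨ cong (λ x → + h + - 1ℤ * (1ℤ + x)) (trans (ℤP.pos-+ h (h ℕ.+ 0)) (cong (λ y → + h + + y) (ℕP.+-identityʳ h))) ⟩
    + h + - 1ℤ * (1ℤ + (+ h + + h))
      ≡⟨ ring (+ h) ⟩
    - (1ℤ + + h) ∎
    where ring : ∀ x → x + - 1ℤ * (1ℤ + (x + x)) ≡ - (1ℤ + x)
          ring = solve-∀
  even : altMoment (2 ℕ.* suc h) ≡ - + suc h
  even = subst (λ m → altMoment m ≡ - + suc h) 2+n≡2*[1+h] even′
  odd′ : altMoment (suc (suc (suc n))) ≡ + suc h
  odd′ = begin
    altMoment (suc (suc n)) + alt (suc (suc n)) * + suc (suc n)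
      ≡⟨ cong₂ (λ m s → m + s * + suc (suc n)) even′ (trans (ℤP.neg-involutive _) (alt-2* h)) ⟩
    - (1ℤ + + h) + 1ℤ * (1ℤ + (1ℤ + + (h ℕ.+ (h ℕ.+ 0))))
      ≡⟨ cong (λ x → - (1ℤ + + h) + 1ℤ * (1ℤ + (1ℤ + x))) (trans (ℤP.pos-+ h (h ℕ.+ 0)) (cong (λ y → + h + + y) (ℕP.+-identityʳ h))) ⟩
    - (1ℤ + + h) + 1ℤ * (1ℤ + (1ℤ + (+ h + + h)))
      ≡⟨ ring (+ h) ⟩
    1ℤ + + h ∎
    where ring : ∀ x → - (1ℤ + x) + 1ℤ * (1ℤ + (1ℤ + (x + x))) ≡ 1ℤ + x
          ring = solve-∀
  odd : altMoment (suc (2 ℕ.* suc h)) ≡ + suc h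
  odd = subst (λ m → altMoment (suc m) ≡ + suc h) 2+n≡2*[1+h] odd′

mk-even : ∀ h → mk (4 ℕ.+ 2 ℕ.* h) ≡ suc h
mk-even h = begin
  (3 ℕ.+ 2 ℕ.* h) / 2        ≡⟨ cong (_/ 2) (eq h) ⟩
  (1 ℕ.+ suc h ℕ.* 2) / 2    ≡⟨ +-distrib-/-∣ʳ 1 {suc h ℕ.* 2} {2} (divides-refl (suc h)) ⟩
  0 ℕ.+ suc h ℕ.* 2 / 2      ≡⟨ m*n/n≡m (suc h) 2 ⟩
  suc h                      ∎
  where open ≡-Reasoning
        eq : ∀ h → 3 ℕ.+ 2 ℕ.* h ≡ 1 ℕ.+ suc h ℕ.* 2
        eq = ℕSolver.solve-∀

mk-odd : ∀ h → mk (5 ℕ.+ 2 ℕ.* h) ≡ 2 ℕ.+ h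
mk-odd h = trans (cong (_/ 2) (eq h)) (m*n/n≡m (2 ℕ.+ h) 2)
  where eq : ∀ h → 4 ℕ.+ 2 ℕ.* h ≡ (2 ℕ.+ h) ℕ.* 2
        eq = ℕSolver.solve-∀

pos-2*+ : ∀ c h → + (c ℕ.+ 2 ℕ.* h) ≡ + c + (+ h + + h)
pos-2*+ c h = trans (ℤP.pos-+ c (2 ℕ.* h))
  (cong (λ y → + c + y) (trans (ℤP.pos-+ h (h ℕ.+ 0)) (cong (λ y → + h + + y) (ℕP.+-identityʳ h))))

-- For k = 4 + k' the hook sums of C₁ and C₂ have length k + 1 and k; the
-- weighted sign sums, corrected by the coefficient m of xy, are divisible by k - 2.
hook-constant-C₁ : ∀ k' → + (2 ℕ.+ k') ∣ altMoment (5 ℕ.+ k') + alt (5 ℕ.+ k') + + mk (4 ℕ.+ k')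
hook-constant-C₁ k' with even-or-odd k'
... | h , inj₁ refl = divides 1ℤ (begin
  altMoment (5 ℕ.+ 2 ℕ.* h) + alt (5 ℕ.+ 2 ℕ.* h) + + mk (4 ℕ.+ 2 ℕ.* h)
    ≡⟨ cong₂ (λ n m → altMoment n + alt n + + m) (eq h) (mk-even h) ⟩
  altMoment (suc (2 ℕ.* (2 ℕ.+ h))) + alt (suc (2 ℕ.* (2 ℕ.+ h))) + + suc h
    ≡⟨ cong₂ (λ a s → a + s + + suc h) (proj₂ (altMoment-even-odd (2 ℕ.+ h))) (alt-odd (2 ℕ.+ h)) ⟩
  + (2 ℕ.+ h) + - 1ℤ + + suc h
    ≡⟨ ring (+ h) ⟩
  1ℤ * (+ 2 + (+ h + + h))
    ≡⟨ cong (1ℤ *_) (pos-2*+ 2 h) ⟨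
  1ℤ * + (2 ℕ.+ 2 ℕ.* h) ∎)
  where open ≡-Reasoning
        eq : ∀ h → 5 ℕ.+ 2 ℕ.* h ≡ suc (2 ℕ.* (2 ℕ.+ h))
        eq = ℕSolver.solve-∀
        ring : ∀ x → (+ 2 + x) + - 1ℤ + (1ℤ + x) ≡ 1ℤ * (+ 2 + (x + x))
        ring = solve-∀
... | h , inj₂ refl = divides 0ℤ (begin
  altMoment (6 ℕ.+ 2 ℕ.* h) + alt (6 ℕ.+ 2 ℕ.* h) + + mk (5 ℕ.+ 2 ℕ.* h)
    ≡⟨ cong₂ (λ n m → altMoment n + alt n + + m) (eq h) (mk-odd h) ⟩
  altMoment (2 ℕ.* (3 ℕ.+ h)) + alt (2 ℕ.* (3 ℕ.+ h)) + + (2 ℕ.+ h)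
    ≡⟨ cong₂ (λ a s → a + s + + (2 ℕ.+ h)) (proj₁ (altMoment-even-odd (3 ℕ.+ h))) (alt-2* (3 ℕ.+ h)) ⟩
  - + (3 ℕ.+ h) + 1ℤ + + (2 ℕ.+ h)
    ≡⟨ ring (+ h) ⟩
  0ℤ * + (3 ℕ.+ 2 ℕ.* h) ∎)
  where open ≡-Reasoning
        eq : ∀ h → 6 ℕ.+ 2 ℕ.* h ≡ 2 ℕ.* (3 ℕ.+ h)
        eq = ℕSolver.solve-∀
        ring : ∀ x → - (+ 3 + x) + 1ℤ + (+ 2 + x) ≡ 0ℤ * + (3 ℕ.+ 2 ℕ.* h)
        ring x = trans (solve₀ x) (sym (ℤP.*-zeroˡ (+ (3 ℕ.+ 2 ℕ.* h))))
          where solve₀ : ∀ x → - (+ 3 + x) + 1ℤ + (+ 2 + x) ≡ 0ℤ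
                solve₀ = solve-∀

hook-constant-C₂ : ∀ k' → + (2 ℕ.+ k') ∣ altMoment (4 ℕ.+ k') + alt (4 ℕ.+ k') + + mk (4 ℕ.+ k')
hook-constant-C₂ k' with even-or-odd k'
... | h , inj₁ refl = divides 0ℤ (begin
  altMoment (4 ℕ.+ 2 ℕ.* h) + alt (4 ℕ.+ 2 ℕ.* h) + + mk (4 ℕ.+ 2 ℕ.* h)
    ≡⟨ cong₂ (λ n m → altMoment n + alt n + + m) (eq h) (mk-even h) ⟩
  altMoment (2 ℕ.* (2 ℕ.+ h)) + alt (2 ℕ.* (2 ℕ.+ h)) + + suc h
    ≡⟨ cong₂ (λ a s → a + s + + suc h) (proj₁ (altMoment-even-odd (2 ℕ.+ h))) (alt-2* (2 ℕ.+ h)) ⟩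
  - + (2 ℕ.+ h) + 1ℤ + + suc h
    ≡⟨ ring (+ h) ⟩
  0ℤ
    ≡⟨ ℤP.*-zeroˡ (+ (2 ℕ.+ 2 ℕ.* h)) ⟨
  0ℤ * + (2 ℕ.+ 2 ℕ.* h) ∎)
  where open ≡-Reasoning
        eq : ∀ h → 4 ℕ.+ 2 ℕ.* h ≡ 2 ℕ.* (2 ℕ.+ h)
        eq = ℕSolver.solve-∀
        ring : ∀ x → - (+ 2 + x) + 1ℤ + (1ℤ + x) ≡ 0ℤ
        ring = solve-∀
... | h , inj₂ refl = divides 1ℤ (begin
  altMoment (5 ℕ.+ 2 ℕ.* h) + alt (5 ℕ.+ 2 ℕ.* h) + + mk (5 ℕ.+ 2 ℕ.* h)
    ≡⟨ cong₂ (λ n m → altMoment n + alt n + + m) (eq h) (mk-odd h) ⟩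
  altMoment (suc (2 ℕ.* (2 ℕ.+ h))) + alt (suc (2 ℕ.* (2 ℕ.+ h))) + + (2 ℕ.+ h)
    ≡⟨ cong₂ (λ a s → a + s + + (2 ℕ.+ h)) (proj₂ (altMoment-even-odd (2 ℕ.+ h))) (alt-odd (2 ℕ.+ h)) ⟩
  + (2 ℕ.+ h) + - 1ℤ + + (2 ℕ.+ h)
    ≡⟨ ring (+ h) ⟩
  1ℤ * (+ 3 + (+ h + + h))
    ≡⟨ cong (1ℤ *_) (pos-2*+ 3 h) ⟨
  1ℤ * + (3 ℕ.+ 2 ℕ.* h) ∎)
  where open ≡-Reasoning
        eq : ∀ h → 5 ℕ.+ 2 ℕ.* h ≡ suc (2 ℕ.* (2 ℕ.+ h))
        eq = ℕSolver.solve-∀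
        ring : ∀ x → (+ 2 + x) + - 1ℤ + (+ 2 + x) ≡ 1ℤ * (+ 3 + (x + x))
        ring = solve-∀

-- Twisted functionals (k = 4 + k')

module Functionals (k' : ℕ) where

  k : ℕ
  k = 4 ℕ.+ k'

  -- A term x^a y^b is indexed by a + stride * b; modulo period = 2k this
  -- is a - b, i.e. the functionals below see y as the inverse of x.
  period stride : ℕ
  period = 8 ℕ.+ 2 ℕ.* k'
  stride = 7 ℕ.+ 2 ℕ.* k'

  period≡2*k : period ≡ 2 ℕ.* k
  period≡2*k = eq k' where eq : ∀ k' → 8 ℕ.+ 2 ℕ.* k' ≡ 2 ℕ.* (4 ℕ.+ k')
                           eq = ℕSolver.solve-∀

  alt-+period : ∀ n → alt (n ℕ.+ period) ≡ alt n
  alt-+period n = trans (cong (λ m → alt (n ℕ.+ m)) period≡2*k) (alt-+2* n k)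

  alt-+period* : ∀ n t → alt (n ℕ.+ period ℕ.* t) ≡ alt n
  alt-+period* n t = trans (cong alt (eq k' n t)) (alt-+2* n (k ℕ.* t))
    where eq : ∀ k' n t → n ℕ.+ (8 ℕ.+ 2 ℕ.* k') ℕ.* t ≡ n ℕ.+ 2 ℕ.* ((4 ℕ.+ k') ℕ.* t)
          eq = ℕSolver.solve-∀

  alt-stride : ∀ a b → alt (a ℕ.+ stride ℕ.* b) ≡ alt (a ℕ.+ b)
  alt-stride a b = trans (cong alt (eq k' a b)) (alt-+2* (a ℕ.+ b) ((3 ℕ.+ k') ℕ.* b))
    where eq : ∀ k' a b → a ℕ.+ (7 ℕ.+ 2 ℕ.* k') ℕ.* b ≡ a ℕ.+ b ℕ.+ 2 ℕ.* ((3 ℕ.+ k') ℕ.* b)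
          eq = ℕSolver.solve-∀

  -- The functional x^a y^b ↦ L a b on ℤ[x,y]; the two laws are what make it
  -- vanish on the ideal modulo β (k - 2).
  record Functional : Set where
    field
      H        : ℕ → ℤ
      β        : ℤ
      H-period : ∀ n → H (n ℕ.+ period) ≡ H n + + 2 * β * alt n
      H-window : sumℤ period H ≡ - β

    L : ℕ → ℕ → ℤ
    L a b = H (a ℕ.+ stride ℕ.* b) - β * alt (a ℕ.+ b) * + b

    H-periods : ∀ n t → H (n ℕ.+ period ℕ.* t) ≡ H n + + 2 * β * alt n * + t
    H-periods n zero = begin
      H (n ℕ.+ period ℕ.* 0)         ≡⟨ cong H (trans (cong (n ℕ.+_) (ℕP.*-zeroʳ period)) (ℕP.+-identityʳ n)) ⟩
      H n                            ≡⟨ ℤP.+-identityʳ (H n) ⟨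
      H n + 0ℤ                       ≡⟨ cong (λ s → H n + s) (ℤP.*-zeroʳ (+ 2 * β * alt n)) ⟨
      H n + + 2 * β * alt n * + 0    ∎
      where open ≡-Reasoning
    H-periods n (suc t) = begin
      H (n ℕ.+ period ℕ.* suc t)
        ≡⟨ cong H (eq n period t) ⟩
      H (n ℕ.+ period ℕ.* t ℕ.+ period)
        ≡⟨ H-period (n ℕ.+ period ℕ.* t) ⟩
      H (n ℕ.+ period ℕ.* t) + + 2 * β * alt (n ℕ.+ period ℕ.* t)
        ≡⟨ cong₂ (λ x s → x + + 2 * β * s) (H-periods n t) (alt-+period* n t) ⟩
      H n + + 2 * β * alt n * + t + + 2 * β * alt n
        ≡⟨ collect (H n) (+ 2 * β * alt n) (+ t) ⟩
      H n + + 2 * β * alt n * + suc t ∎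
      where open ≡-Reasoning
            eq : ∀ n p t → n ℕ.+ p ℕ.* suc t ≡ n ℕ.+ p ℕ.* t ℕ.+ p
            eq = ℕSolver.solve-∀
            collect : ∀ h c t → h + c * t + c ≡ h + c * (1ℤ + t)
            collect = solve-∀

    H-window-at : ∀ n → sumℤ period (λ e → H (n ℕ.+ e)) ≡ - (β * alt n)
    H-window-at zero    = trans H-window (cong -_ (sym (ℤP.*-identityʳ β)))
    H-window-at (suc n) = begin
      sumℤ stride (λ e → H (suc n ℕ.+ e)) + H (suc n ℕ.+ stride)
        ≡⟨ cong₂ _+_ (sumℤ-cong stride (λ e _ → cong H (sym (ℕP.+-suc n e))))
                     (trans (cong H (sym (ℕP.+-suc n stride))) (H-period n)) ⟩
      sumℤ stride (λ e → H (n ℕ.+ suc e)) + (H n + + 2 * β * alt n)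
        ≡⟨ rotate (sumℤ stride (λ e → H (n ℕ.+ suc e))) (H n) (+ 2 * β * alt n) ⟩
      (H n + sumℤ stride (λ e → H (n ℕ.+ suc e))) + + 2 * β * alt n
        ≡⟨ cong (λ x → (H x + sumℤ stride (λ e → H (n ℕ.+ suc e))) + + 2 * β * alt n) (sym (ℕP.+-identityʳ n)) ⟩
      (H (n ℕ.+ 0) + sumℤ stride (λ e → H (n ℕ.+ suc e))) + + 2 * β * alt n
        ≡⟨ cong (_+ + 2 * β * alt n) (sumℤ-suc stride (λ e → H (n ℕ.+ e))) ⟨
      sumℤ period (λ e → H (n ℕ.+ e)) + + 2 * β * alt n
        ≡⟨ cong (_+ + 2 * β * alt n) (H-window-at n) ⟩
      - (β * alt n) + + 2 * β * alt n
        ≡⟨ flip β (alt n) ⟩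
      - (β * - alt n) ∎
      where open ≡-Reasoning
            rotate : ∀ S h c → S + (h + c) ≡ (h + S) + c
            rotate = solve-∀
            flip : ∀ b s → - (b * s) + + 2 * b * s ≡ - (b * - s)
            flip = solve-∀

    L-diagonal : ∀ a b → L (suc a) (suc b) ≡ L a b + β * alt (a ℕ.+ b)
    L-diagonal a b = begin
      H (suc a ℕ.+ stride ℕ.* suc b) - β * alt (suc a ℕ.+ suc b) * + suc b
        ≡⟨ cong₂ (λ n s → H n - β * s * + suc b) (index k' a b) alt-2+ ⟩
      H (a ℕ.+ stride ℕ.* b ℕ.+ period) - β * alt (a ℕ.+ b) * (1ℤ + + b)
        ≡⟨ cong (_- β * alt (a ℕ.+ b) * (1ℤ + + b)) (H-period (a ℕ.+ stride ℕ.* b)) ⟩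
      H (a ℕ.+ stride ℕ.* b) + + 2 * β * alt (a ℕ.+ stride ℕ.* b) - β * alt (a ℕ.+ b) * (1ℤ + + b)
        ≡⟨ cong (λ s → H (a ℕ.+ stride ℕ.* b) + + 2 * β * s - β * alt (a ℕ.+ b) * (1ℤ + + b)) (alt-stride a b) ⟩
      H (a ℕ.+ stride ℕ.* b) + + 2 * β * alt (a ℕ.+ b) - β * alt (a ℕ.+ b) * (1ℤ + + b)
        ≡⟨ collect (H (a ℕ.+ stride ℕ.* b)) β (alt (a ℕ.+ b)) (+ b) ⟩
      L a b + β * alt (a ℕ.+ b) ∎
      where
      open ≡-Reasoning
      index : ∀ k' a b → suc a ℕ.+ (7 ℕ.+ 2 ℕ.* k') ℕ.* suc b ≡ a ℕ.+ (7 ℕ.+ 2 ℕ.* k') ℕ.* b ℕ.+ (8 ℕ.+ 2 ℕ.* k')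
      index = ℕSolver.solve-∀
      alt-2+ : alt (suc a ℕ.+ suc b) ≡ alt (a ℕ.+ b)
      alt-2+ = trans (cong (λ m → - alt m) (ℕP.+-suc a b)) (ℤP.neg-involutive _)
      collect : ∀ h b s B → h + + 2 * b * s - b * s * (1ℤ + B) ≡ h - b * s * B + b * s
      collect = solve-∀

  -- The hook at (p , q) with arms of lengths u and v indexes one full window of
  -- the period; the window law and quasi-periodicity evaluate it.
  module _ (φ : Functional) where
    open Functional φ

    hook-sum : ∀ u v p q → suc u ℕ.+ v ≡ period →
               hook (suc u) v (shift p q L) ≡ β * alt (p ℕ.+ q) * (altMoment (suc u) + alt (suc u))
    hook-sum u v p q uv≡period = begin
      hook (suc u) v (shift p q L)
        ≡⟨ cong₂ _+_ vertical horizontal ⟩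
      (SV + c * (+ q * A + M)) + (SZ + c * (+ q * B))
        ≡⟨ cong (λ B → (SV + c * (+ q * A + M)) + (SZ + c * (+ q * B))) B≡-A ⟩
      (SV + c * (+ q * A + M)) + (SZ + c * (+ q * - A))
        ≡⟨ regroup SV SZ β σ (+ q) (+ u) A M ⟩
      ((SV + d * (+ u * A - M)) + (SZ + d * (+ u * - A))) + β * σ * M
        ≡⟨ cong (λ w → w + β * σ * M) (trans window (cong (λ B → (SV + d * (+ u * A - M)) + (SZ + d * (+ u * B))) B≡-A)) ⟨
      - (β * alt W) + β * σ * M
        ≡⟨ cong (λ s → - (β * s) + β * σ * M) alt-W ⟩
      - (β * (σ * alt u)) + β * σ * M
        ≡⟨ finish β σ (alt u) M ⟩
      β * σ * (M + alt (suc u)) ∎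
      where
      open ≡-Reasoning
      σ  = alt (p ℕ.+ q)
      c  = - (β * σ)
      d  = + 2 * β * σ
      n₀ = p ℕ.+ stride ℕ.* q
      W  = n₀ ℕ.+ stride ℕ.* u
      A  = sumℤ (suc u) alt
      B  = sumℤ v (λ i → alt (suc i))
      M  = altMoment (suc u)
      SV = sumℤ (suc u) (λ j → H (n₀ ℕ.+ stride ℕ.* j))
      SZ = sumℤ v (λ i → H (n₀ ℕ.+ suc i))

      regroup : ∀ SV SZ b σ q u A M →
        (SV + - (b * σ) * (q * A + M)) + (SZ + - (b * σ) * (q * - A)) ≡
        ((SV + + 2 * b * σ * (u * A - M)) + (SZ + + 2 * b * σ * (u * - A))) + b * σ * M
      regroup = solve-∀
      finish : ∀ b σ a M → - (b * (σ * a)) + b * σ * M ≡ b * σ * (M + - a)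
      finish = solve-∀

      alt-σ : ∀ e → alt (p ℕ.+ q ℕ.+ e) ≡ σ * alt e
      alt-σ e = alt-+ (p ℕ.+ q) e

      alt-n₀ : ∀ e → alt (n₀ ℕ.+ e) ≡ σ * alt e
      alt-n₀ e = trans (cong alt (eq k' p q e)) (trans (alt-stride (p ℕ.+ e) q) (trans (cong alt (eq₂ p q e)) (alt-σ e)))
        where eq : ∀ k' p q e → p ℕ.+ (7 ℕ.+ 2 ℕ.* k') ℕ.* q ℕ.+ e ≡ p ℕ.+ e ℕ.+ (7 ℕ.+ 2 ℕ.* k') ℕ.* q
              eq = ℕSolver.solve-∀
              eq₂ : ∀ p q e → p ℕ.+ e ℕ.+ q ≡ p ℕ.+ q ℕ.+ e
              eq₂ = ℕSolver.solve-∀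

      alt-W : alt W ≡ σ * alt u
      alt-W = trans (cong alt (eq k' p q u)) (trans (alt-stride p (q ℕ.+ u)) (trans (cong alt (sym (ℕP.+-assoc p q u))) (alt-σ u)))
        where eq : ∀ k' p q u → p ℕ.+ (7 ℕ.+ 2 ℕ.* k') ℕ.* q ℕ.+ (7 ℕ.+ 2 ℕ.* k') ℕ.* u ≡ p ℕ.+ (7 ℕ.+ 2 ℕ.* k') ℕ.* (q ℕ.+ u)
              eq = ℕSolver.solve-∀

      B≡-A : B ≡ - A
      B≡-A = trans (sumℤ-neg v alt) (cong -_ (sumℤ-alt-parity v (suc u) k (trans (ℕP.+-comm v (suc u)) (trans uv≡period period≡2*k))))

      vertical : sumℤ (suc u) (λ j → shift p q L 0 j) ≡ SV + c * (+ q * A + M)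
      vertical = begin
        sumℤ (suc u) (λ j → shift p q L 0 j)
          ≡⟨ sumℤ-cong (suc u) (λ j _ → point j) ⟩
        sumℤ (suc u) (λ j → H (n₀ ℕ.+ stride ℕ.* j) + c * (+ q * alt j + alt j * + j))
          ≡⟨ sumℤ-+* (suc u) c _ _ ⟩
        SV + c * sumℤ (suc u) (λ j → + q * alt j + alt j * + j)
          ≡⟨ cong (λ s → SV + c * s) (trans (sumℤ-+ (suc u) _ _) (cong (_+ M) (sumℤ-*ˡ (suc u) (+ q) alt))) ⟩
        SV + c * (+ q * A + M) ∎
        where
        index : ∀ k' p q j → p ℕ.+ 0 ℕ.+ (7 ℕ.+ 2 ℕ.* k') ℕ.* (q ℕ.+ j) ≡ p ℕ.+ (7 ℕ.+ 2 ℕ.* k') ℕ.* q ℕ.+ (7 ℕ.+ 2 ℕ.* k') ℕ.* j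
        index = ℕSolver.solve-∀
        ring : ∀ h b σ a Q j → h - b * (σ * a) * (Q + j) ≡ h + - (b * σ) * (Q * a + a * j)
        ring = solve-∀
        point : ∀ j → shift p q L 0 j ≡ H (n₀ ℕ.+ stride ℕ.* j) + c * (+ q * alt j + alt j * + j)
        point j = begin
          H (p ℕ.+ 0 ℕ.+ stride ℕ.* (q ℕ.+ j)) - β * alt (p ℕ.+ 0 ℕ.+ (q ℕ.+ j)) * + (q ℕ.+ j)
            ≡⟨ cong₂ (λ n s → H n - β * s * + (q ℕ.+ j)) (index k' p q j)
                     (trans (cong alt (trans (cong (ℕ._+ (q ℕ.+ j)) (ℕP.+-identityʳ p)) (sym (ℕP.+-assoc p q j)))) (alt-σ j)) ⟩
          H (n₀ ℕ.+ stride ℕ.* j) - β * (σ * alt j) * + (q ℕ.+ j)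
            ≡⟨ cong (λ x → H (n₀ ℕ.+ stride ℕ.* j) - β * (σ * alt j) * x) (ℤP.pos-+ q j) ⟩
          H (n₀ ℕ.+ stride ℕ.* j) - β * (σ * alt j) * (+ q + + j)
            ≡⟨ ring (H (n₀ ℕ.+ stride ℕ.* j)) β σ (alt j) (+ q) (+ j) ⟩
          H (n₀ ℕ.+ stride ℕ.* j) + c * (+ q * alt j + alt j * + j) ∎

      horizontal : sumℤ v (λ i → shift p q L (suc i) 0) ≡ SZ + c * (+ q * B)
      horizontal = trans (sumℤ-cong v (λ i _ → point i))
                         (trans (sumℤ-+* v c _ _) (cong (λ s → SZ + c * s) (sumℤ-*ˡ v (+ q) (λ i → alt (suc i)))))
        where
        index : ∀ k' p q i → p ℕ.+ suc i ℕ.+ (7 ℕ.+ 2 ℕ.* k') ℕ.* (q ℕ.+ 0) ≡ p ℕ.+ (7 ℕ.+ 2 ℕ.* k') ℕ.* q ℕ.+ suc i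
        index = ℕSolver.solve-∀
        eq : ∀ p q i → p ℕ.+ suc i ℕ.+ (q ℕ.+ 0) ≡ p ℕ.+ q ℕ.+ suc i
        eq = ℕSolver.solve-∀
        ring : ∀ h b σ a Q → h - b * (σ * a) * Q ≡ h + - (b * σ) * (Q * a)
        ring = solve-∀
        point : ∀ i → shift p q L (suc i) 0 ≡ H (n₀ ℕ.+ suc i) + c * (+ q * alt (suc i))
        point i = trans (cong₂ (λ n s → H n - β * s * + (q ℕ.+ 0)) (index k' p q i) (trans (cong alt (eq p q i)) (alt-σ (suc i))))
                        (trans (cong (λ x → H (n₀ ℕ.+ suc i) - β * (σ * alt (suc i)) * + x) (ℕP.+-identityʳ q))
                               (ring (H (n₀ ℕ.+ suc i)) β σ (alt (suc i)) (+ q)))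

      window : - (β * alt W) ≡ (SV + d * (+ u * A - M)) + (SZ + d * (+ u * B))
      window = begin
        - (β * alt W)
          ≡⟨ H-window-at W ⟨
        sumℤ period (λ e → H (W ℕ.+ e))
          ≡⟨ cong (λ N → sumℤ N (λ e → H (W ℕ.+ e))) (sym uv≡period) ⟩
        sumℤ (suc u ℕ.+ v) (λ e → H (W ℕ.+ e))
          ≡⟨ sumℤ-split (suc u) v _ ⟩
        sumℤ (suc u) (λ e → H (W ℕ.+ e)) + sumℤ v (λ i → H (W ℕ.+ (suc u ℕ.+ i)))
          ≡⟨ cong₂ _+_ first second ⟩
        (SV + d * (+ u * A - M)) + (SZ + d * (+ u * B)) ∎
        where
        ring : ∀ h b σ a U j → h + + 2 * b * (σ * a) * (U - j) ≡ h + + 2 * b * σ * (U * a - a * j)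
        ring = solve-∀
        back : ∀ j → j ℕ.< suc u → H (W ℕ.+ (u ℕ.∸ j)) ≡ H (n₀ ℕ.+ stride ℕ.* j) + d * (+ u * alt j - alt j * + j)
        back j j<1+u = begin
          H (W ℕ.+ (u ℕ.∸ j))
            ≡⟨ cong H (index (ℕP.m+[n∸m]≡n (ℕP.≤-pred j<1+u))) ⟩
          H (n₀ ℕ.+ stride ℕ.* j ℕ.+ period ℕ.* (u ℕ.∸ j))
            ≡⟨ H-periods (n₀ ℕ.+ stride ℕ.* j) (u ℕ.∸ j) ⟩
          H (n₀ ℕ.+ stride ℕ.* j) + + 2 * β * alt (n₀ ℕ.+ stride ℕ.* j) * + (u ℕ.∸ j)
            ≡⟨ cong₂ (λ s x → H (n₀ ℕ.+ stride ℕ.* j) + + 2 * β * s * x) (trans (alt-n₀ (stride ℕ.* j)) (cong (σ *_) (alt-stride 0 j)))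
                     (trans (sym (ℤP.⊖-≥ (ℕP.≤-pred j<1+u))) (sym (ℤP.[+m]-[+n]≡m⊖n u j))) ⟩
          H (n₀ ℕ.+ stride ℕ.* j) + + 2 * β * (σ * alt j) * (+ u - + j)
            ≡⟨ ring (H (n₀ ℕ.+ stride ℕ.* j)) β σ (alt j) (+ u) (+ j) ⟩
          H (n₀ ℕ.+ stride ℕ.* j) + d * (+ u * alt j - alt j * + j) ∎
          where
          index : j ℕ.+ (u ℕ.∸ j) ≡ u → W ℕ.+ (u ℕ.∸ j) ≡ n₀ ℕ.+ stride ℕ.* j ℕ.+ period ℕ.* (u ℕ.∸ j)
          index eq = trans (cong (λ x → n₀ ℕ.+ stride ℕ.* x ℕ.+ (u ℕ.∸ j)) (sym eq)) (gen k' n₀ j (u ℕ.∸ j))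
            where gen : ∀ k' n j r → n ℕ.+ (7 ℕ.+ 2 ℕ.* k') ℕ.* (j ℕ.+ r) ℕ.+ r ≡ n ℕ.+ (7 ℕ.+ 2 ℕ.* k') ℕ.* j ℕ.+ (8 ℕ.+ 2 ℕ.* k') ℕ.* r
                  gen = ℕSolver.solve-∀
        first : sumℤ (suc u) (λ e → H (W ℕ.+ e)) ≡ SV + d * (+ u * A - M)
        first = trans (sumℤ-reverse (suc u) _)
          (trans (sumℤ-cong (suc u) back)
            (trans (sumℤ-+* (suc u) d _ _)
              (cong (λ s → SV + d * s) (trans (sumℤ-+ (suc u) _ _)
                 (cong₂ _+_ (sumℤ-*ˡ (suc u) (+ u) alt) (sumℤ-neg (suc u) (λ j → alt j * + j)))))))
        front : ∀ i → H (W ℕ.+ (suc u ℕ.+ i)) ≡ H (n₀ ℕ.+ suc i) + d * (+ u * alt (suc i))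
        front i = begin
          H (W ℕ.+ (suc u ℕ.+ i))
            ≡⟨ cong H (index k' n₀ u i) ⟩
          H (n₀ ℕ.+ suc i ℕ.+ period ℕ.* u)
            ≡⟨ H-periods (n₀ ℕ.+ suc i) u ⟩
          H (n₀ ℕ.+ suc i) + + 2 * β * alt (n₀ ℕ.+ suc i) * + u
            ≡⟨ cong (λ s → H (n₀ ℕ.+ suc i) + + 2 * β * s * + u) (alt-n₀ (suc i)) ⟩
          H (n₀ ℕ.+ suc i) + + 2 * β * (σ * alt (suc i)) * + u
            ≡⟨ ring′ (H (n₀ ℕ.+ suc i)) β σ (alt (suc i)) (+ u) ⟩
          H (n₀ ℕ.+ suc i) + d * (+ u * alt (suc i)) ∎
          where
          index : ∀ k' n u i → n ℕ.+ (7 ℕ.+ 2 ℕ.* k') ℕ.* u ℕ.+ (suc u ℕ.+ i) ≡ n ℕ.+ suc i ℕ.+ (8 ℕ.+ 2 ℕ.* k') ℕ.* u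
          index = ℕSolver.solve-∀
          ring′ : ∀ h b σ a U → h + + 2 * b * (σ * a) * U ≡ h + + 2 * b * σ * (U * a)
          ring′ = solve-∀
        second : sumℤ v (λ i → H (W ℕ.+ (suc u ℕ.+ i))) ≡ SZ + d * (+ u * B)
        second = trans (sumℤ-cong v (λ i _ → front i))
                       (trans (sumℤ-+* v d _ _) (cong (λ s → SZ + d * s) (sumℤ-*ˡ v (+ u) (λ i → alt (suc i)))))

-- Pairing the generators (k = 2 + n) with an arbitrary function on terms

private
  factor : ∀ c a b → c * a - c * b ≡ c * (a - b)
  factor = solve-∀

module _ (n : ℕ) (F : ℕ → ℕ → ℤ) where
  private
    k = 2 ℕ.+ n
    N = 3 ℕ.+ n
    0<N : 0 ℕ.< N
    0<N = s≤s z≤n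
    1<N : 1 ℕ.< N
    1<N = s≤s (s≤s z≤n)
    2<N : 2 ℕ.< N
    2<N = s≤s (s≤s (s≤s z≤n))
    unit : ∀ M (f : ℕ → ℤ) → sumℤ M (λ i → 1ℤ * f i) ≡ sumℤ M f
    unit M f = sumℤ-cong M (λ i _ → ℤP.*-identityˡ (f i))
    pairing-xy-1 : pairing N N (mono (+ mk k) 1 1) F - pairing N N (mono (+ mk k) 0 0) F ≡ + mk k * (F 1 1 - F 0 0)
    pairing-xy-1 = trans (cong₂ _-_ (pairing-mono N N (+ mk k) 1 1 F 1<N 1<N) (pairing-mono N N (+ mk k) 0 0 F 0<N 0<N))
                         (factor (+ mk k) (F 1 1) (F 0 0))

  pairing-C₁ : pairing N N (C₁ k) F ≡ hook N (suc n) F + + mk k * (F 1 1 - F 0 0)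
  pairing-C₁ = begin
    pairing N N (C₁ k) F
      ≡⟨ pairing-⊖ N N ((Y ⊕ X) ⊕ mono (+ mk k) 1 1) (mono (+ mk k) 0 0) F ⟩
    pairing N N ((Y ⊕ X) ⊕ mono (+ mk k) 1 1) F - pairing N N (mono (+ mk k) 0 0) F
      ≡⟨ cong (_- pairing N N (mono (+ mk k) 0 0) F) (trans (pairing-⊕ N N (Y ⊕ X) (mono (+ mk k) 1 1) F) (cong (_+ pairing N N (mono (+ mk k) 1 1) F) (pairing-⊕ N N Y X F))) ⟩
    (pairing N N Y F + pairing N N X F) + pairing N N (mono (+ mk k) 1 1) F - pairing N N (mono (+ mk k) 0 0) F
      ≡⟨ ℤP.+-assoc (pairing N N Y F + pairing N N X F) _ _ ⟩
    (pairing N N Y F + pairing N N X F) + (pairing N N (mono (+ mk k) 1 1) F - pairing N N (mono (+ mk k) 0 0) F)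
      ≡⟨ cong₂ _+_ (cong₂ _+_ vertical horizontal) pairing-xy-1 ⟩
    hook N (suc n) F + + mk k * (F 1 1 - F 0 0) ∎
    where
    open ≡-Reasoning
    Y = ΣP N (λ j → mono 1ℤ 0 j)
    X = ΣP (suc n) (λ i → mono 1ℤ (suc i) 0)
    vertical : pairing N N Y F ≡ sumℤ N (λ j → F 0 j)
    vertical = trans (pairing-ΣP N N N _ F) (trans (sumℤ-cong N (λ j j<N → pairing-mono N N 1ℤ 0 j F 0<N j<N)) (unit N (F 0)))
    horizontal : pairing N N X F ≡ sumℤ (suc n) (λ i → F (suc i) 0)
    horizontal = trans (pairing-ΣP N N (suc n) _ F)
      (trans (sumℤ-cong (suc n) (λ i i<1+n → pairing-mono N N 1ℤ (suc i) 0 F (s≤s (ℕP.m<n⇒m<1+n i<1+n)) 0<N)) (unit (suc n) (λ i → F (suc i) 0)))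

  pairing-C₂ : pairing N N (C₂ k) F ≡ hook k k F + + mk k * (F 1 1 - F 0 0)
  pairing-C₂ = begin
    pairing N N (C₂ k) F
      ≡⟨ pairing-⊖ N N ((X ⊕ Y) ⊕ mono (+ mk k) 1 1) (mono (+ mk k) 0 0) F ⟩
    pairing N N ((X ⊕ Y) ⊕ mono (+ mk k) 1 1) F - pairing N N (mono (+ mk k) 0 0) F
      ≡⟨ cong (_- pairing N N (mono (+ mk k) 0 0) F) (trans (pairing-⊕ N N (X ⊕ Y) (mono (+ mk k) 1 1) F) (cong (_+ pairing N N (mono (+ mk k) 1 1) F) (pairing-⊕ N N X Y F))) ⟩
    (pairing N N X F + pairing N N Y F) + pairing N N (mono (+ mk k) 1 1) F - pairing N N (mono (+ mk k) 0 0) F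
      ≡⟨ ℤP.+-assoc (pairing N N X F + pairing N N Y F) _ _ ⟩
    (pairing N N X F + pairing N N Y F) + (pairing N N (mono (+ mk k) 1 1) F - pairing N N (mono (+ mk k) 0 0) F)
      ≡⟨ cong₂ _+_ (cong₂ _+_ horizontal vertical) pairing-xy-1 ⟩
    (F 0 0 + sumℤ k (λ i → F (suc i) 0)) + sumℤ (suc n) (λ j → F 0 (suc j)) + + mk k * (F 1 1 - F 0 0)
      ≡⟨ cong (_+ + mk k * (F 1 1 - F 0 0)) (regroup (F 0 0) _ _) ⟩
    (F 0 0 + sumℤ (suc n) (λ j → F 0 (suc j))) + sumℤ k (λ i → F (suc i) 0) + + mk k * (F 1 1 - F 0 0)
      ≡⟨ cong (λ s → s + sumℤ k (λ i → F (suc i) 0) + + mk k * (F 1 1 - F 0 0)) (sumℤ-suc (suc n) (F 0)) ⟨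
    hook k k F + + mk k * (F 1 1 - F 0 0) ∎
    where
    open ≡-Reasoning
    X = ΣP N (λ i → mono 1ℤ i 0)
    Y = ΣP (suc n) (λ j → mono 1ℤ 0 (suc j))
    regroup : ∀ a b c → (a + b) + c ≡ (a + c) + b
    regroup = solve-∀
    horizontal : pairing N N X F ≡ F 0 0 + sumℤ k (λ i → F (suc i) 0)
    horizontal = trans (pairing-ΣP N N N _ F)
      (trans (sumℤ-cong N (λ i i<N → pairing-mono N N 1ℤ i 0 F i<N 0<N)) (trans (unit N (λ i → F i 0)) (sumℤ-suc k (λ i → F i 0))))
    vertical : pairing N N Y F ≡ sumℤ (suc n) (λ j → F 0 (suc j))
    vertical = trans (pairing-ΣP N N (suc n) _ F)
      (trans (sumℤ-cong (suc n) (λ j j<1+n → pairing-mono N N 1ℤ 0 (suc j) F 0<N (s≤s (ℕP.m<n⇒m<1+n j<1+n)))) (unit (suc n) (λ j → F 0 (suc j))))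

  pairing-C₃ : pairing N N (C₃ k) F ≡ ((F 2 1 + F 1 1) - F 1 0) - F 0 0
  pairing-C₃ =
    trans (pairing-⊖ N N ((mono 1ℤ 2 1 ⊕ mono 1ℤ 1 1) ⊖ mono 1ℤ 1 0) (mono 1ℤ 0 0) F)
      (cong₂ _-_ (trans (pairing-⊖ N N (mono 1ℤ 2 1 ⊕ mono 1ℤ 1 1) (mono 1ℤ 1 0) F)
                   (cong₂ _-_ (trans (pairing-⊕ N N (mono 1ℤ 2 1) (mono 1ℤ 1 1) F) (cong₂ _+_ (one 2 1 2<N 1<N) (one 1 1 1<N 1<N))) (one 1 0 1<N 0<N)))
                 (one 0 0 0<N 0<N))
    where one : ∀ a b → a ℕ.< N → b ℕ.< N → pairing N N (mono 1ℤ a b) F ≡ F a b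
          one a b a<N b<N = trans (pairing-mono N N 1ℤ a b F a<N b<N) (ℤP.*-identityˡ (F a b))

  pairing-C₄ : pairing N N (C₄ k) F ≡ ((F 1 2 + F 1 1) - F 0 1) - F 0 0
  pairing-C₄ =
    trans (pairing-⊖ N N ((mono 1ℤ 1 2 ⊕ mono 1ℤ 1 1) ⊖ mono 1ℤ 0 1) (mono 1ℤ 0 0) F)
      (cong₂ _-_ (trans (pairing-⊖ N N (mono 1ℤ 1 2 ⊕ mono 1ℤ 1 1) (mono 1ℤ 0 1) F)
                   (cong₂ _-_ (trans (pairing-⊕ N N (mono 1ℤ 1 2) (mono 1ℤ 1 1) F) (cong₂ _+_ (one 1 2 1<N 2<N) (one 1 1 1<N 1<N))) (one 0 1 0<N 1<N)))
                 (one 0 0 0<N 0<N))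
    where one : ∀ a b → a ℕ.< N → b ℕ.< N → pairing N N (mono 1ℤ a b) F ≡ F a b
          one a b a<N b<N = trans (pairing-mono N N 1ℤ a b F a<N b<N) (ℤP.*-identityˡ (F a b))

  pairing-C₅ : pairing N N (C₅ k) F ≡ + n * (F 1 1 - F 0 0)
  pairing-C₅ = trans (pairing-⊖ N N (mono (+ n) 1 1) (mono (+ n) 0 0) F)
    (trans (cong₂ _-_ (pairing-mono N N (+ n) 1 1 F 1<N 1<N) (pairing-mono N N (+ n) 0 0 F 0<N 0<N))
           (factor (+ n) (F 1 1) (F 0 0)))

module Generators (k' : ℕ) where
  open Functionals k'
  open Functional

  modulus : Functional → ℤ
  modulus φ = β φ * + (k ℕ.∸ 2)

  module _ (φ : Functional) (p q : ℕ) where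
    private
      F = shift p q (L φ)
      b = β φ
      σ = alt (p ℕ.+ q)

      F-diagonal : ∀ a c → F (suc a) (suc c) ≡ F a c + b * alt (p ℕ.+ a ℕ.+ (q ℕ.+ c))
      F-diagonal a c = trans (cong₂ (L φ) (ℕP.+-suc p a) (ℕP.+-suc q c)) (L-diagonal φ (p ℕ.+ a) (q ℕ.+ c))

      F-11 : F 1 1 ≡ F 0 0 + b * σ
      F-11 = trans (F-diagonal 0 0) (cong (λ n → F 0 0 + b * alt n) (eq p q))
        where eq : ∀ p q → p ℕ.+ 0 ℕ.+ (q ℕ.+ 0) ≡ p ℕ.+ q
              eq = ℕSolver.solve-∀

      F-odd : ∀ a c → a ℕ.+ c ≡ 1 → F (suc a) (suc c) ≡ F a c + b * - σ
      F-odd a c a+c≡1 = trans (F-diagonal a c) (cong (λ n → F a c + b * alt n) (trans (eq p q a c) (trans (cong (λ m → p ℕ.+ q ℕ.+ m) a+c≡1) (ℕP.+-comm (p ℕ.+ q) 1))))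
        where eq : ∀ p q a c → p ℕ.+ a ℕ.+ (q ℕ.+ c) ≡ p ℕ.+ q ℕ.+ (a ℕ.+ c)
              eq = ℕSolver.solve-∀

      multiple : ∀ {X} → + (k ℕ.∸ 2) ∣ X → modulus φ ∣ b * σ * X
      multiple {X} (divides z X≡z*m) = divides (σ * z) (trans (cong (b * σ *_) X≡z*m) (ring b σ z (+ (k ℕ.∸ 2))))
        where ring : ∀ b σ z m → b * σ * (z * m) ≡ σ * z * (b * m)
              ring = solve-∀

      F-11-00 : F 1 1 - F 0 0 ≡ b * σ
      F-11-00 = trans (cong (_- F 0 0) F-11) (cancel (F 0 0) (b * σ))
        where cancel : ∀ x y → x + y - x ≡ y
              cancel = solve-∀

      hook-generator : ∀ u v → suc u ℕ.+ v ≡ period → + (k ℕ.∸ 2) ∣ altMoment (suc u) + alt (suc u) + + mk k →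
                       modulus φ ∣ hook (suc u) v F + + mk k * (F 1 1 - F 0 0)
      hook-generator u v uv≡period m∣X = subst (modulus φ ∣_) (sym value) (multiple m∣X)
        where
        ring : ∀ b σ M a m → b * σ * (M + a) + m * (b * σ) ≡ b * σ * (M + a + m)
        ring = solve-∀
        value : hook (suc u) v F + + mk k * (F 1 1 - F 0 0) ≡ b * σ * (altMoment (suc u) + alt (suc u) + + mk k)
        value = trans (cong₂ (λ h d → h + + mk k * d) (hook-sum φ u v p q uv≡period) F-11-00)
                      (ring b σ (altMoment (suc u)) (alt (suc u)) (+ mk k))

      -- C₃ = (x + 1)(xy - 1) and C₄ = (y + 1)(xy - 1): the two diagonal steps carry opposite signs.
      diagonal-steps-cancel : ∀ a c → a ℕ.+ c ≡ 1 → ((F (suc a) (suc c) + F 1 1) - F a c) - F 0 0 ≡ 0ℤ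
      diagonal-steps-cancel a c a+c≡1 =
        trans (cong₂ (λ x y → ((x + y) - F a c) - F 0 0) (F-odd a c a+c≡1) F-11) (cancel (F a c) (F 0 0) b σ)
        where cancel : ∀ x y b σ → ((x + b * - σ) + (y + b * σ) - x) - y ≡ 0ℤ
              cancel = solve-∀

      zero-multiple : ∀ {X} → X ≡ 0ℤ → modulus φ ∣ X
      zero-multiple refl = divides 0ℤ (sym (ℤP.*-zeroˡ (modulus φ)))

    generator-annihilated : ∀ i → modulus φ ∣ pairing (suc k) (suc k) (C k i) F
    generator-annihilated Fin.zero =
      subst (modulus φ ∣_) (sym (pairing-C₁ (2 ℕ.+ k') F))
            (hook-generator (4 ℕ.+ k') (3 ℕ.+ k') (eq k') (hook-constant-C₁ k'))
      where eq : ∀ k' → 5 ℕ.+ k' ℕ.+ (3 ℕ.+ k') ≡ 8 ℕ.+ 2 ℕ.* k'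
            eq = ℕSolver.solve-∀
    generator-annihilated (Fin.suc Fin.zero) =
      subst (modulus φ ∣_) (sym (pairing-C₂ (2 ℕ.+ k') F))
            (hook-generator (3 ℕ.+ k') (4 ℕ.+ k') (eq k') (hook-constant-C₂ k'))
      where eq : ∀ k' → 4 ℕ.+ k' ℕ.+ (4 ℕ.+ k') ≡ 8 ℕ.+ 2 ℕ.* k'
            eq = ℕSolver.solve-∀
    generator-annihilated (Fin.suc (Fin.suc Fin.zero)) =
      zero-multiple (trans (pairing-C₃ (2 ℕ.+ k') F) (diagonal-steps-cancel 1 0 refl))
    generator-annihilated (Fin.suc (Fin.suc (Fin.suc Fin.zero))) =
      zero-multiple (trans (pairing-C₄ (2 ℕ.+ k') F) (diagonal-steps-cancel 0 1 refl))
    generator-annihilated (Fin.suc (Fin.suc (Fin.suc (Fin.suc Fin.zero)))) =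
      divides σ (trans (pairing-C₅ (2 ℕ.+ k') F) (trans (cong (+ (k ℕ.∸ 2) *_) F-11-00) (ring (+ (k ℕ.∸ 2)) b σ)))
      where ring : ∀ m b σ → m * (b * σ) ≡ σ * (b * m)
            ring = solve-∀

-- Head terms of the generators (k = 3 + n)

_≤T_ : Term → Term → Set
t ≤T t' = t ≡ t' ⊎ t <T t'

mono-above : ∀ c a b {tp t} → (a , b) ≤T tp → tp <T t → mono c a b t ≡ 0ℤ
mono-above c a b (inj₁ refl) tp<t = mono-≢ c a b _ (≢-sym (<T-irrefl tp<t))
mono-above c a b (inj₂ ab<tp) tp<t = mono-≢ c a b _ (≢-sym (<T-irrefl (<T-trans ab<tp tp<t)))

ΣP-above : ∀ N (f : ℕ → Poly) {tp t} → (∀ j → j ℕ.< N → ∀ t → tp <T t → f j t ≡ 0ℤ) → tp <T t → ΣP N f t ≡ 0ℤ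
ΣP-above N f f-above tp<t = trans (ΣP-apply N f _) (sumℤ-zero N (λ j j<N → f-above j j<N _ tp<t))

module Heads (n : ℕ) where

  k : ℕ
  k = 3 ℕ.+ n

  head : Fin 5 → Term
  head Fin.zero                                         = (0 , k)
  head (Fin.suc Fin.zero)                               = (k , 0)
  head (Fin.suc (Fin.suc Fin.zero))                     = (2 , 1)
  head (Fin.suc (Fin.suc (Fin.suc Fin.zero)))           = (1 , 2)
  head (Fin.suc (Fin.suc (Fin.suc (Fin.suc Fin.zero)))) = (1 , 1)

  head-coeff : Fin 5 → ℤ
  head-coeff (Fin.suc (Fin.suc (Fin.suc (Fin.suc Fin.zero)))) = + (k ℕ.∸ 2)
  head-coeff _ = 1ℤ

  head-coeff≢0 : ∀ i → head-coeff i ≢ 0ℤ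
  head-coeff≢0 Fin.zero                                         ()
  head-coeff≢0 (Fin.suc Fin.zero)                               ()
  head-coeff≢0 (Fin.suc (Fin.suc Fin.zero))                     ()
  head-coeff≢0 (Fin.suc (Fin.suc (Fin.suc Fin.zero)))           ()
  head-coeff≢0 (Fin.suc (Fin.suc (Fin.suc (Fin.suc Fin.zero)))) ()

  private
    deg-below : ∀ {a b c d} → a ℕ.+ b ℕ.< c ℕ.+ d → (a , b) ≤T (c , d)
    deg-below lt = inj₂ (inj₁ lt)

    small<k : ∀ a b → a ℕ.+ b ℕ.≤ 2 → a ℕ.+ b ℕ.< k
    small<k a b le = s≤s (ℕP.≤-trans le (s≤s (s≤s z≤n)))

    small<k+0 : ∀ a b → a ℕ.+ b ℕ.≤ 2 → a ℕ.+ b ℕ.< k ℕ.+ 0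
    small<k+0 a b le = subst (a ℕ.+ b ℕ.<_) (sym (ℕP.+-identityʳ k)) (small<k a b le)

  C-at-head : ∀ i → C k i (head i) ≡ head-coeff i
  C-at-head Fin.zero = cong₂ (λ y x → ((y + x) + mono (+ mk k) 1 1 (0 , k)) - mono (+ mk k) 0 0 (0 , k))
    (trans (ΣP-apply (suc k) _ _) (trans (sumℤ-single (suc k) k _ ℕP.≤-refl (λ j _ j≢k → mono-≢ 1ℤ 0 j (0 , k) (λ eq → j≢k (sym (cong proj₂ eq))))) (mono-at 1ℤ 0 k)))
    (trans (ΣP-apply (k ℕ.∸ 1) _ _) (sumℤ-zero (k ℕ.∸ 1) (λ i _ → mono-≢ 1ℤ (suc i) 0 (0 , k) (λ ()))))
  C-at-head (Fin.suc Fin.zero) = cong₂ (λ x y → ((x + y) + mono (+ mk k) 1 1 (k , 0)) - mono (+ mk k) 0 0 (k , 0))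
    (trans (ΣP-apply (suc k) _ _) (trans (sumℤ-single (suc k) k _ ℕP.≤-refl (λ i _ i≢k → mono-≢ 1ℤ i 0 (k , 0) (λ eq → i≢k (sym (cong proj₁ eq))))) (mono-at 1ℤ k 0)))
    (trans (ΣP-apply (k ℕ.∸ 1) _ _) (sumℤ-zero (k ℕ.∸ 1) (λ j _ → mono-≢ 1ℤ 0 (suc j) (k , 0) (λ ()))))
  C-at-head (Fin.suc (Fin.suc Fin.zero)) = refl
  C-at-head (Fin.suc (Fin.suc (Fin.suc Fin.zero))) = refl
  C-at-head (Fin.suc (Fin.suc (Fin.suc (Fin.suc Fin.zero)))) = ℤP.+-identityʳ _

  C-above-head : ∀ i t → head i <T t → C k i t ≡ 0ℤ
  C-above-head Fin.zero t h<t = trans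
    (cong₂ (λ y x → ((y + x) + mono (+ mk k) 1 1 t) - mono (+ mk k) 0 0 t)
      (ΣP-above (suc k) _ (λ j j≤k _ → mono-above 1ℤ 0 j (≤-top (ℕP.≤-pred j≤k))) h<t)
      (ΣP-above (k ℕ.∸ 1) _ (λ i i<k-1 _ → mono-above 1ℤ (suc i) 0 (deg-below (subst (ℕ._< k) (sym (ℕP.+-identityʳ (suc i))) (s≤s i<k-1)))) h<t))
    (cong₂ (λ u v → ((0ℤ + 0ℤ) + u) - v) (mono-above _ 1 1 (deg-below (small<k 1 1 ℕP.≤-refl)) h<t)
                                         (mono-above _ 0 0 (deg-below (small<k 0 0 z≤n)) h<t))
    where
    ≤-top : ∀ {j} → j ℕ.≤ k → (0 , j) ≤T (0 , k)
    ≤-top j≤k with ℕP.m≤n⇒m<n∨m≡n j≤k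
    ... | inj₁ j<k  = deg-below j<k
    ... | inj₂ refl = inj₁ refl
  C-above-head (Fin.suc Fin.zero) t h<t = trans
    (cong₂ (λ x y → ((x + y) + mono (+ mk k) 1 1 t) - mono (+ mk k) 0 0 t)
      (ΣP-above (suc k) _ (λ i i≤k _ → mono-above 1ℤ i 0 (≤-top (ℕP.≤-pred i≤k))) h<t)
      (ΣP-above (k ℕ.∸ 1) _ (λ j j<k-1 _ → mono-above 1ℤ 0 (suc j) (deg-below (subst (suc j ℕ.<_) (sym (ℕP.+-identityʳ k)) (s≤s j<k-1)))) h<t))
    (cong₂ (λ u v → ((0ℤ + 0ℤ) + u) - v) (mono-above _ 1 1 (deg-below (small<k+0 1 1 ℕP.≤-refl)) h<t)
                                         (mono-above _ 0 0 (deg-below (small<k+0 0 0 z≤n)) h<t))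
    where
    ≤-top : ∀ {i} → i ℕ.≤ k → (i , 0) ≤T (k , 0)
    ≤-top i≤k with ℕP.m≤n⇒m<n∨m≡n i≤k
    ... | inj₁ i<k  = deg-below (subst₂ ℕ._<_ (sym (ℕP.+-identityʳ _)) (sym (ℕP.+-identityʳ k)) i<k)
    ... | inj₂ refl = inj₁ refl
  C-above-head (Fin.suc (Fin.suc Fin.zero)) t h<t = trans
    (cong₂ (λ x y → ((x + y) - mono 1ℤ 1 0 t) - mono 1ℤ 0 0 t)
          (mono-above _ 2 1 (inj₁ refl) h<t) (mono-above _ 1 1 (deg-below (s≤s (s≤s (s≤s z≤n)))) h<t))
    (cong₂ (λ x y → ((0ℤ + 0ℤ) - x) - y)
          (mono-above _ 1 0 (deg-below (s≤s (s≤s z≤n))) h<t) (mono-above _ 0 0 (deg-below (s≤s z≤n)) h<t))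
  C-above-head (Fin.suc (Fin.suc (Fin.suc Fin.zero))) t h<t = trans
    (cong₂ (λ x y → ((x + y) - mono 1ℤ 0 1 t) - mono 1ℤ 0 0 t)
          (mono-above _ 1 2 (inj₁ refl) h<t) (mono-above _ 1 1 (deg-below (s≤s (s≤s (s≤s z≤n)))) h<t))
    (cong₂ (λ x y → ((0ℤ + 0ℤ) - x) - y)
          (mono-above _ 0 1 (deg-below (s≤s (s≤s z≤n))) h<t) (mono-above _ 0 0 (deg-below (s≤s z≤n)) h<t))
  C-above-head (Fin.suc (Fin.suc (Fin.suc (Fin.suc Fin.zero)))) t h<t =
    cong₂ _-_ (mono-above _ 1 1 (inj₁ refl) h<t) (mono-above _ 0 0 (deg-below (s≤s z≤n)) h<t)

  C-head : ∀ i → IsHT (C k i) (head i)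
  C-head i = (λ eq → head-coeff≢0 i (trans (sym (C-at-head i)) eq)) , C-above-head i

  C-Deg≤ : ∀ i → Deg≤ k (C k i)
  C-Deg≤ i t k<t = C-above-head i t (inj₁ (ℕP.≤-<-trans (deg-head i) k<t))
    where
    deg-head : ∀ i → deg (head i) ℕ.≤ k
    deg-head Fin.zero = ℕP.≤-refl
    deg-head (Fin.suc Fin.zero) = ℕP.≤-reflexive (ℕP.+-identityʳ k)
    deg-head (Fin.suc (Fin.suc Fin.zero)) = s≤s (s≤s (s≤s z≤n))
    deg-head (Fin.suc (Fin.suc (Fin.suc Fin.zero))) = s≤s (s≤s (s≤s z≤n))
    deg-head (Fin.suc (Fin.suc (Fin.suc (Fin.suc Fin.zero)))) = s≤s (s≤s z≤n)

module Annihilation (k' : ℕ) where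
  open Functionals k'
  open Functional using (L)
  open Generators k'
  open Heads (suc k') using (C-Deg≤)

  Annihilated : Poly → Set
  Annihilated g = ∃[ d ] (Deg≤ d g × ∀ φ → modulus φ ∣ pairing (suc d) (suc d) g (L φ))

  Annihilated-≈ : ∀ {g g'} → g ≈P g' → Annihilated g → Annihilated g'
  Annihilated-≈ g≈g' (d , g≤d , ann) =
    d , (λ t lt → trans (sym (g≈g' t)) (g≤d t lt)) ,
    (λ φ → subst (modulus φ ∣_) (pairing-cong (suc d) (suc d) (L φ) g≈g') (ann φ))

  Annihilated-0 : Annihilated 0P
  Annihilated-0 = 0 , (λ _ _ → refl) , (λ φ → divides 0ℤ (trans (sum²-zero 1 1 (λ _ _ → refl)) (sym (ℤP.*-zeroˡ (modulus φ)))))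

  private
    common-box : ∀ {d d' g} φ → Deg≤ d g → d ℕ.≤ d' →
                 pairing (suc d') (suc d') g (L φ) ≡ pairing (suc d) (suc d) g (L φ)
    common-box {d' = d'} φ g≤d d≤d' = pairing-Deg≤ (suc d') (suc d') (L φ) g≤d (s≤s d≤d') (s≤s d≤d')

  Annihilated-⊕ : ∀ {g g'} → Annihilated g → Annihilated g' → Annihilated (g ⊕ g')
  Annihilated-⊕ {g} {g'} (d , g≤d , ann) (d' , g'≤d' , ann') = d ⊔ d' , Deg≤-⊕ g≤d g'≤d' , λ φ →
    subst (modulus φ ∣_)
      (sym (trans (pairing-⊕ (suc (d ⊔ d')) (suc (d ⊔ d')) g g' (L φ))
                  (cong₂ _+_ (common-box φ g≤d (ℕP.m≤m⊔n d d')) (common-box φ g'≤d' (ℕP.m≤n⊔m d d')))))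
      (∣m∣n⇒∣m+n (ann φ) (ann' φ))

  Annihilated-⊖ : ∀ {g g'} → Annihilated g → Annihilated g' → Annihilated (g ⊖ g')
  Annihilated-⊖ {g} {g'} (d , g≤d , ann) (d' , g'≤d' , ann') = d ⊔ d' , Deg≤-⊖ g≤d g'≤d' , λ φ →
    subst (modulus φ ∣_)
      (sym (trans (pairing-⊖ (suc (d ⊔ d')) (suc (d ⊔ d')) g g' (L φ))
                  (cong₂ _-_ (common-box φ g≤d (ℕP.m≤m⊔n d d')) (common-box φ g'≤d' (ℕP.m≤n⊔m d d')))))
      (∣m∣n⇒∣m-n (ann φ) (ann' φ))

  Annihilated-ΣP : ∀ N (f : ℕ → Poly) → (∀ j → Annihilated (f j)) → Annihilated (ΣP N f)
  Annihilated-ΣP zero    f ann = Annihilated-0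
  Annihilated-ΣP (suc N) f ann = Annihilated-⊕ (Annihilated-ΣP N f ann) (ann N)

  Annihilated-ΣFin : ∀ N (f : Fin N → Poly) → (∀ i → Annihilated (f i)) → Annihilated (ΣFin N f)
  Annihilated-ΣFin zero    f ann = Annihilated-0
  Annihilated-ΣFin (suc N) f ann = Annihilated-⊕ (ann Fin.zero) (Annihilated-ΣFin N (λ i → f (Fin.suc i)) (λ i → ann (Fin.suc i)))

  Annihilated-multiple : ∀ c s i → Annihilated (mulMono c s (C k i))
  Annihilated-multiple c (p , q) i = p ℕ.+ q ℕ.+ k , Deg≤-mulMono c p q (C-Deg≤ i) , λ φ →
    subst (modulus φ ∣_) (sym (pairing-mulMono c p q (L φ) (C-Deg≤ i))) (∣n⇒∣m*n c (generator-annihilated φ p q i))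

  Annihilated-⊗ : ∀ {h} i → IsPoly h → Annihilated (h ⊗ C k i)
  Annihilated-⊗ {h} i (d , h≤d) =
    Annihilated-≈ (λ t → sym (⊗-as-ΣP (C k i) h≤d t))
      (Annihilated-ΣP (suc d) _ (λ a → Annihilated-ΣP (suc d) _ (λ b → Annihilated-multiple (h (a , b)) (a , b) i)))

  Annihilated-ideal : ∀ {f} → InIdeal (C k) f → Annihilated f
  Annihilated-ideal (hs , hs-poly , f≈) =
    Annihilated-≈ (λ t → sym (f≈ t)) (Annihilated-ΣFin 5 _ (λ i → Annihilated-⊗ i (hs-poly i)))

  Annihilated-SPoly : ∀ i j {h} → IsSPoly (C k i) (C k j) h → Annihilated h
  Annihilated-SPoly i j (t₁ , t₂ , _ , _ , b₁ , b₂ , _ , _ , h≈) =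
    Annihilated-≈ (λ t → sym (h≈ t))
      (Annihilated-⊖ (Annihilated-multiple b₁ (lcmT t₁ t₂ -T t₁) i) (Annihilated-multiple b₂ (lcmT t₁ t₂ -T t₂) j))

  Annihilated-step : ∀ {f g} → Step (C k) f g → Annihilated f → Annihilated g
  Annihilated-step (i , _ , _ , s , c , _ , _ , g≈) ann =
    Annihilated-≈ (λ t → sym (g≈ t)) (Annihilated-⊖ ann (Annihilated-multiple c s i))

δ : ℕ → ℕ → ℤ
δ r₀ r = if does (r ℕ.≟ r₀) then 1ℤ else 0ℤ
  where open import Data.Bool using (if_then_else_)

δ-same : ∀ r → δ r r ≡ 1ℤ
δ-same r rewrite dec-true (r ℕ.≟ r) refl = refl

δ-≢ : ∀ {r₀ r} → r ≢ r₀ → δ r₀ r ≡ 0ℤ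
δ-≢ {r₀} {r} r≢r₀ rewrite dec-false (r ℕ.≟ r₀) r≢r₀ = refl

sumℤ-δ : ∀ r₀ N → r₀ ℕ.< N → sumℤ N (δ r₀) ≡ 1ℤ
sumℤ-δ r₀ N r₀<N = trans (sumℤ-single N r₀ (δ r₀) r₀<N (λ r _ r≢r₀ → δ-≢ r≢r₀)) (δ-same r₀)

-- Functionals triangular at x^i, y^j and xy

module TriangularFunctionals (k' : ℕ) where
  open Functionals k'

  0<period : 0 ℕ.< period
  0<period = s≤s z≤n

  -- Named so that `rewrite` sees them with their NonZero instance already resolved.
  private
    mod-period : ∀ n → (n ℕ.+ period) % period ≡ n % period
    mod-period n = [m+n]%n≡m%n n period

    div-period : ∀ n → (n ℕ.+ period) / period ≡ 1 ℕ.+ (n ℕ.+ period ℕ.∸ period) / period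
    div-period n = m/n≡1+[m∸n]/n (ℕP.m≤n+m period n)

  extension : (ℕ → ℤ) → ℤ → ℕ → ℤ
  extension base β n = base (n % period) + + 2 * β * alt n * + (n / period)

  extension-small : ∀ base β n → n ℕ.< period → extension base β n ≡ base n
  extension-small base β n n<P rewrite m<n⇒m%n≡m n<P | m<n⇒m/n≡0 n<P =
    trans (cong (λ s → base n + s) (ℤP.*-zeroʳ (+ 2 * β * alt n))) (ℤP.+-identityʳ (base n))

  extension-period : ∀ base β n → extension base β (n ℕ.+ period) ≡ extension base β n + + 2 * β * alt n
  extension-period base β n rewrite mod-period n | alt-+period n | div-period n | ℕP.m+n∸n≡m n period =
    ring (base (n % period)) (+ 2 * β * alt n) (+ (n / period))
    where ring : ∀ x c q → x + c * (1ℤ + q) ≡ x + c * q + c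
          ring = solve-∀

  extend : (base : ℕ → ℤ) (β : ℤ) → sumℤ period base ≡ - β → Functional
  extend base β window = record
    { H        = extension base β
    ; β        = β
    ; H-period = extension-period base β
    ; H-window = trans (sumℤ-cong period (λ e e<P → extension-small base β e e<P)) window
    }

  k<period : k ℕ.< period
  k<period = subst (5 ℕ.+ k' ℕ.≤_) (eq k') (ℕP.m≤m+n (5 ℕ.+ k') (3 ℕ.+ k'))
    where eq : ∀ k' → 5 ℕ.+ k' ℕ.+ (3 ℕ.+ k') ≡ 8 ℕ.+ 2 ℕ.* k'
          eq = ℕSolver.solve-∀

  -- For a term of degree < k the index a + stride b is a - b modulo the period.
  data Residue (a b : ℕ) : ℕ → Set where
    below-diagonal : ∀ c → a ≡ b ℕ.+ c → Residue a b c
    above-diagonal : ∀ e → b ≡ a ℕ.+ suc e → Residue a b (stride ℕ.∸ e)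

  residue : ∀ a b → a ℕ.+ b ℕ.< k → Residue a b ((a ℕ.+ stride ℕ.* b) % period)
  residue a b a+b<k with b ℕ.≤? a
  ... | yes b≤a with ℕP.m≤n⇒∃[o]m+o≡n b≤a
  ...   | c , refl = subst (Residue (b ℕ.+ c) b) (sym index) (below-diagonal c refl)
    where
    c<period : c ℕ.< period
    c<period = ℕP.≤-<-trans (ℕP.m≤n+m c b) (ℕP.≤-<-trans (ℕP.m≤m+n (b ℕ.+ c) b) (ℕP.<-trans a+b<k k<period))
    eq : ∀ k' b c → b ℕ.+ c ℕ.+ (7 ℕ.+ 2 ℕ.* k') ℕ.* b ≡ c ℕ.+ b ℕ.* (8 ℕ.+ 2 ℕ.* k')
    eq = ℕSolver.solve-∀
    index : (b ℕ.+ c ℕ.+ stride ℕ.* b) % period ≡ c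
    index = trans (cong (_% period) (eq k' b c)) (trans ([m+kn]%n≡m%n c b period) (m<n⇒m%n≡m c<period))
  residue a b a+b<k | no b≰a with ℕP.m≤n⇒∃[o]m+o≡n (ℕP.≰⇒> b≰a)
  ...   | e , refl = subst (Residue a (suc a ℕ.+ e)) (sym index) (above-diagonal e (sym (ℕP.+-suc a e)))
    where
    e≤stride : e ℕ.≤ stride
    e≤stride = ℕP.≤-trans (ℕP.m≤n+m e (suc a)) (ℕP.≤-trans (ℕP.m≤n+m _ a) (ℕP.≤-trans (ℕP.<⇒≤ a+b<k) (ℕP.≤-pred k<period)))
    f = stride ℕ.∸ e
    e+f≡stride : e ℕ.+ f ≡ stride
    e+f≡stride = ℕP.m+[n∸m]≡n e≤stride
    eq : ∀ a e f → a ℕ.+ (e ℕ.+ f) ℕ.* (suc a ℕ.+ e) ≡ f ℕ.+ (a ℕ.+ e) ℕ.* suc (e ℕ.+ f)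
    eq = ℕSolver.solve-∀
    index : (a ℕ.+ stride ℕ.* (suc a ℕ.+ e)) % period ≡ f
    index = begin
      (a ℕ.+ stride ℕ.* (suc a ℕ.+ e)) % period
        ≡⟨ cong (λ s → (a ℕ.+ s ℕ.* (suc a ℕ.+ e)) % period) (sym e+f≡stride) ⟩
      (a ℕ.+ (e ℕ.+ f) ℕ.* (suc a ℕ.+ e)) % period
        ≡⟨ cong (_% period) (trans (eq a e f) (cong (λ s → f ℕ.+ (a ℕ.+ e) ℕ.* suc s) e+f≡stride)) ⟩
      (f ℕ.+ (a ℕ.+ e) ℕ.* period) % period
        ≡⟨ [m+kn]%n≡m%n f (a ℕ.+ e) period ⟩
      f % period
        ≡⟨ m<n⇒m%n≡m (s≤s (ℕP.m∸n≤m stride e)) ⟩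
      f ∎
      where open ≡-Reasoning

  -- Subtracting δ k makes the window sum vanish; k is never the residue of a term of degree < k.
  indicator : ∀ r₀ → r₀ ℕ.< period → Functional
  indicator r₀ r₀<P = extend (λ r → δ r₀ r - δ k r) 0ℤ
    (trans (sumℤ-+ period (δ r₀) (λ r → - δ k r))
           (trans (cong₂ _+_ (sumℤ-δ r₀ period r₀<P) (trans (sumℤ-neg period (δ k)) (cong -_ (sumℤ-δ k period k<period))))
                  refl))

  indicator-L : ∀ r₀ r₀<P a b → Functional.L (indicator r₀ r₀<P) a b ≡ δ r₀ ((a ℕ.+ stride ℕ.* b) % period) - δ k ((a ℕ.+ stride ℕ.* b) % period)
  indicator-L r₀ r₀<P a b = ring (δ r₀ r - δ k r) (alt (a ℕ.+ stride ℕ.* b)) (+ ((a ℕ.+ stride ℕ.* b) / period)) (alt (a ℕ.+ b)) (+ b)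
    where r = (a ℕ.+ stride ℕ.* b) % period
          ring : ∀ x s q s' b → x + + 2 * 0ℤ * s * q - 0ℤ * s' * b ≡ x
          ring = solve-∀

  indicator-residue : ∀ r₀ r₀<P a b → a ℕ.+ b ℕ.< k →
                      ∃[ r ] Residue a b r × Functional.L (indicator r₀ r₀<P) a b ≡ δ r₀ r - δ k r
  indicator-residue r₀ r₀<P a b a+b<k = _ , residue a b a+b<k , indicator-L r₀ r₀<P a b

  k<stride∸ : ∀ {e} → suc (suc e) ℕ.≤ k → k ℕ.< stride ℕ.∸ e
  k<stride∸ {e} 2+e≤k = ℕP.m+n≤o⇒m≤o∸n (suc k)
    (ℕP.≤-trans (ℕP.≤-reflexive (sym (ℕP.+-suc k e))) (ℕP.≤-trans (ℕP.+-monoʳ-≤ k (ℕP.≤-pred 2+e≤k)) (ℕP.≤-reflexive (eq k'))))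
    where eq : ∀ k' → 4 ℕ.+ k' ℕ.+ (3 ℕ.+ k') ≡ 7 ℕ.+ 2 ℕ.* k'
          eq = ℕSolver.solve-∀

  residue-large : ∀ {a b e} → b ≡ a ℕ.+ suc e → a ℕ.+ b ℕ.< k → k ℕ.< stride ℕ.∸ e
  residue-large {a} {b} {e} refl a+b<k = k<stride∸ (ℕP.≤-<-trans (ℕP.m≤n+m (suc e) a) (ℕP.≤-<-trans (ℕP.m≤n+m (a ℕ.+ suc e) a) a+b<k))

  residue≢k : ∀ {a b r} → a ℕ.+ b ℕ.< k → Residue a b r → r ≢ k
  residue≢k {b = b} a+b<k (below-diagonal c refl) refl = ℕP.<-irrefl refl (ℕP.≤-<-trans (ℕP.≤-trans (ℕP.m≤n+m c b) (ℕP.m≤m+n (b ℕ.+ c) b)) a+b<k)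
  residue≢k a+b<k (above-diagonal e eq) r≡k = ℕP.<-irrefl (sym r≡k) (residue-large eq a+b<k)

  <T-deg≤ : ∀ {a b c d} → (a , b) <T (c , d) → a ℕ.+ b ℕ.≤ c ℕ.+ d
  <T-deg≤ (inj₁ lt) = ℕP.<⇒≤ lt
  <T-deg≤ (inj₂ (eq , _)) = ℕP.≤-reflexive eq

  <T-y-deg : ∀ {a b j} → (a , b) <T (0 , j) → a ℕ.+ b ℕ.< j
  <T-y-deg (inj₁ lt)      = lt
  <T-y-deg (inj₂ (_ , ()))

  no-overshoot : ∀ b c → b ℕ.+ c ℕ.+ b ℕ.≤ c → b ≡ 0
  no-overshoot zero    c _  = refl
  no-overshoot (suc b) c le =
    ⊥-elim (ℕP.<-irrefl refl (ℕP.≤-trans (s≤s (ℕP.≤-trans (ℕP.m≤n+m c b) (ℕP.m≤m+n (b ℕ.+ c) (suc b)))) le))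

  x-functional : ∀ i → i ℕ.< k → Functional
  x-functional i i<k = indicator i (ℕP.<-trans i<k k<period)

  x-functional-at : ∀ i i<k → Functional.L (x-functional i i<k) i 0 ≡ 1ℤ
  x-functional-at i i<k with indicator-residue i (ℕP.<-trans i<k k<period) i 0 (subst (ℕ._< k) (sym (ℕP.+-identityʳ i)) i<k)
  ... | _ , below-diagonal c refl , L≡ = trans L≡ (cong₂ _-_ (δ-same c) (δ-≢ (ℕP.<⇒≢ i<k)))
  ... | _ , above-diagonal e 0≡i+1+e , _ = ⊥-elim (ℕP.0≢1+n (trans 0≡i+1+e (ℕP.+-suc i e)))

  x-functional-below : ∀ i i<k a b → (a , b) <T (i , 0) → Functional.L (x-functional i i<k) a b ≡ 0ℤ
  x-functional-below i i<k a b ab<i with indicator-residue i (ℕP.<-trans i<k k<period) a b a+b<k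
    where a+b<k = ℕP.≤-<-trans (subst (a ℕ.+ b ℕ.≤_) (ℕP.+-identityʳ i) (<T-deg≤ ab<i)) i<k
  ... | r , res , L≡ = trans L≡ (cong₂ _-_ (δ-≢ (r≢i res)) (δ-≢ (residue≢k a+b<k res)))
    where
    a+b≤i : a ℕ.+ b ℕ.≤ i
    a+b≤i = subst (a ℕ.+ b ℕ.≤_) (ℕP.+-identityʳ i) (<T-deg≤ ab<i)
    a+b<k = ℕP.≤-<-trans a+b≤i i<k
    r≢i : ∀ {r} → Residue a b r → r ≢ i
    r≢i (below-diagonal c refl) refl = <T-irrefl ab<i (cong₂ _,_ (cong (ℕ._+ c) b≡0) b≡0)
      where
      b≡0 : b ≡ 0
      b≡0 = no-overshoot b c a+b≤i
    r≢i (above-diagonal e eq) refl = ℕP.<-irrefl refl (ℕP.<-trans i<k (residue-large eq a+b<k))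

  y-functional : ∀ j → suc j ℕ.< k → Functional
  y-functional j _ = indicator (stride ℕ.∸ j) (s≤s (ℕP.m∸n≤m stride j))

  y-functional-at : ∀ j 1+j<k → Functional.L (y-functional j 1+j<k) 0 (suc j) ≡ 1ℤ
  y-functional-at j 1+j<k with indicator-residue (stride ℕ.∸ j) (s≤s (ℕP.m∸n≤m stride j)) 0 (suc j) 1+j<k
  ... | _ , above-diagonal e refl , L≡ = trans L≡ (cong₂ _-_ (δ-same (stride ℕ.∸ e)) (δ-≢ (ℕP.<⇒≢ (k<stride∸ 1+j<k) ∘ sym)))

  y-functional-below : ∀ j 1+j<k a b → (a , b) <T (0 , suc j) → Functional.L (y-functional j 1+j<k) a b ≡ 0ℤ
  y-functional-below j 1+j<k a b ab<y with indicator-residue (stride ℕ.∸ j) (s≤s (ℕP.m∸n≤m stride j)) a b a+b<k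
    where a+b<k = ℕP.<-trans (<T-y-deg ab<y) 1+j<k
  ... | r , res , L≡ = trans L≡ (cong₂ _-_ (δ-≢ (r≢r₀ res)) (δ-≢ (residue≢k a+b<k res)))
    where
    a+b<1+j = <T-y-deg ab<y
    a+b<k = ℕP.<-trans a+b<1+j 1+j<k
    r≢r₀ : ∀ {r} → Residue a b r → r ≢ stride ℕ.∸ j
    r≢r₀ (below-diagonal c refl) refl =
      ℕP.<-irrefl refl (ℕP.<-trans (ℕP.≤-<-trans (ℕP.≤-trans (ℕP.m≤n+m (stride ℕ.∸ j) b) (ℕP.m≤m+n _ b)) a+b<k) (k<stride∸ 1+j<k))
    r≢r₀ (above-diagonal e refl) r≡r₀ = ℕP.<-irrefl (ℕP.∸-cancelˡ-≡ (e≤stride) (j≤stride) r≡r₀) e<j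
      where
      e<j : e ℕ.< j
      e<j = ℕP.≤-pred (ℕP.≤-<-trans (ℕP.≤-trans (ℕP.m≤n+m (suc e) a) (ℕP.m≤n+m _ a)) a+b<1+j)
      j≤stride : j ℕ.≤ stride
      j≤stride = ℕP.<⇒≤ (ℕP.<-≤-trans (ℕP.<-trans (ℕP.n<1+n j) 1+j<k) (ℕP.≤-pred k<period))
      e≤stride : e ℕ.≤ stride
      e≤stride = ℕP.≤-trans (ℕP.<⇒≤ e<j) j≤stride

  -- Detects the coefficient of xy, modulo k - 2.
  twisted-base : ℕ → ℤ
  twisted-base r = - δ stride r

  twisted : Functional
  twisted = extend twisted-base 1ℤ (trans (sumℤ-neg period (δ stride)) (cong -_ (sumℤ-δ stride period ℕP.≤-refl)))

  private
    ext = extension twisted-base 1ℤ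

    twisted-L : ∀ a b {n} → a ℕ.+ stride ℕ.* b ≡ n → Functional.L twisted a b ≡ ext n - alt (a ℕ.+ b) * + b
    twisted-L a b refl = cong (λ s → ext (a ℕ.+ stride ℕ.* b) - s) (cong (_* + b) (ℤP.*-identityˡ (alt (a ℕ.+ b))))

    ext-small : ∀ n → n ℕ.< period → n ≢ stride → ext n ≡ 0ℤ
    ext-small n n<P n≢stride = trans (extension-small twisted-base 1ℤ n n<P) (cong -_ (δ-≢ n≢stride))

  twisted-at : Functional.L twisted 1 1 ≡ 1ℤ
  twisted-at = trans (twisted-L 1 1 (cong suc (ℕP.*-identityʳ stride)))
                     (cong (_- alt 2 * + 1) (trans (extension-period twisted-base 1ℤ 0) (cong (_+ + 2 * 1ℤ * 1ℤ) (ext-small 0 0<period (ℕP.<⇒≢ (s≤s z≤n))))))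

  twisted-below : ∀ a b → (a , b) <T (1 , 1) → Functional.L twisted a b ≡ 0ℤ
  twisted-below 0 0 _ = trans (twisted-L 0 0 (ℕP.*-zeroʳ stride)) (cong (_- alt 0 * + 0) (ext-small 0 0<period (ℕP.<⇒≢ (s≤s z≤n))))
  twisted-below 1 0 _ = trans (twisted-L 1 0 (cong suc (ℕP.*-zeroʳ stride))) (cong (_- alt 1 * + 0) (ext-small 1 (s≤s (s≤s z≤n)) (ℕP.<⇒≢ (s≤s (s≤s z≤n)))))
  twisted-below 0 1 _ = trans (twisted-L 0 1 (ℕP.*-identityʳ stride))
                              (cong (_- alt 1 * + 1) (trans (extension-small twisted-base 1ℤ stride ℕP.≤-refl) (cong -_ (δ-same stride))))
  twisted-below 0 2 _ = trans (twisted-L 0 2 (eq k'))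
    (cong (_- alt 2 * + 2) (trans (extension-period twisted-base 1ℤ (6 ℕ.+ 2 ℕ.* k'))
      (cong₂ (λ x s → x + + 2 * 1ℤ * s) (ext-small (6 ℕ.+ 2 ℕ.* k') (ℕP.<-trans (ℕP.n<1+n _) ℕP.≤-refl) (ℕP.<⇒≢ ℕP.≤-refl))
                                        (trans (cong alt (eq₂ k')) (alt-2* (3 ℕ.+ k'))))))
    where eq : ∀ k' → 0 ℕ.+ (7 ℕ.+ 2 ℕ.* k') ℕ.* 2 ≡ 6 ℕ.+ 2 ℕ.* k' ℕ.+ (8 ℕ.+ 2 ℕ.* k')
          eq = ℕSolver.solve-∀
          eq₂ : ∀ k' → 6 ℕ.+ 2 ℕ.* k' ≡ 2 ℕ.* (3 ℕ.+ k')
          eq₂ = ℕSolver.solve-∀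
  twisted-below 0 (suc (suc (suc b))) (inj₁ (s≤s (s≤s ())))
  twisted-below 1 (suc b) (inj₁ (s≤s (s≤s ())))
  twisted-below 1 (suc b) (inj₂ (_ , s≤s ()))
  twisted-below (suc (suc a)) b (inj₁ (s≤s (s≤s ())))
  twisted-below (suc (suc a)) b (inj₂ (_ , s≤s ()))

module HeadReduction (k' : ℕ) where
  open Functionals k'
  open Functional using (L; β)
  open Generators k' using (modulus)
  open Heads (suc k') using (head; C-at-head; C-head)
  open Annihilation k'
  open TriangularFunctionals k'
  open Reduction (C k) head C-head

  head-multiple : ∀ φ {g a b} → Annihilated g → g (a , b) ≢ 0ℤ → (∀ t → (a , b) <T t → g t ≡ 0ℤ) →
                  (∀ a' b' → (a' , b') <T (a , b) → L φ a' b' ≡ 0ℤ) → L φ a b ≡ 1ℤ → modulus φ ∣ g (a , b)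
  head-multiple φ {g} {a} {b} (d , g≤d , ann) gab≢0 g-above L-below L-at = subst (modulus φ ∣_) pairing≡ (ann φ)
    where pairing≡ : pairing (suc d) (suc d) g (L φ) ≡ g (a , b)
          pairing≡ = trans (pairing-head (L φ) g≤d gab≢0 g-above L-below)
                           (trans (cong (g (a , b) *_) L-at) (ℤP.*-identityʳ (g (a , b))))

  head-vanishes : ∀ φ → β φ ≡ 0ℤ → ∀ {g a b} → Annihilated g → g (a , b) ≢ 0ℤ → (∀ t → (a , b) <T t → g t ≡ 0ℤ) →
                  (∀ a' b' → (a' , b') <T (a , b) → L φ a' b' ≡ 0ℤ) → L φ a b ≡ 1ℤ → g (a , b) ≡ 0ℤ
  head-vanishes φ β≡0 ann gab≢0 g-above L-below L-at =
    0∣⇒≡0 (subst (_∣ _) (trans (cong (_* + (k ℕ.∸ 2)) β≡0) (ℤP.*-zeroˡ (+ (k ℕ.∸ 2))))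
                 (head-multiple φ ann gab≢0 g-above L-below L-at))

  private
    times-unit-head : ∀ (x : ℤ) i → C k i (head i) ≡ 1ℤ → x ≡ x * C k i (head i)
    times-unit-head x i C≡1 = trans (sym (ℤP.*-identityʳ x)) (cong (x *_) (sym C≡1))

  head-reducible : ∀ {g t} → Annihilated g → g t ≢ 0ℤ → (∀ t' → t <T t' → g t' ≡ 0ℤ) → HeadReducible g t
  head-reducible {g} {a , b} ann gab≢0 g-above with k ℕ.≤? b | k ℕ.≤? a
  ... | yes k≤b | _       = # 0 , (a , b ℕ.∸ k) , g (a , b) , cong₂ _,_ (ℕP.+-identityʳ a) (ℕP.m∸n+n≡m k≤b) ,
                            times-unit-head (g (a , b)) (# 0) (C-at-head (# 0))
  ... | no _    | yes k≤a = # 1 , (a ℕ.∸ k , b) , g (a , b) , cong₂ _,_ (ℕP.m∸n+n≡m k≤a) (ℕP.+-identityʳ b) ,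
                            times-unit-head (g (a , b)) (# 1) (C-at-head (# 1))
  ... | no b≱k  | no a≱k  = small a b (ℕP.≰⇒> a≱k) (ℕP.≰⇒> b≱k) gab≢0 g-above
    where
    small : ∀ a b → a ℕ.< k → b ℕ.< k → g (a , b) ≢ 0ℤ → (∀ t → (a , b) <T t → g t ≡ 0ℤ) → HeadReducible g (a , b)
    small 0 0 a<k _ g≢0 above = ⊥-elim (g≢0 (head-vanishes (x-functional 0 a<k) refl ann g≢0 above
      (x-functional-below 0 a<k) (x-functional-at 0 a<k)))
    small (suc a) 0 a<k _ g≢0 above = ⊥-elim (g≢0 (head-vanishes (x-functional (suc a) a<k) refl ann g≢0 above
      (x-functional-below (suc a) a<k) (x-functional-at (suc a) a<k)))
    small 0 (suc b) _ b<k g≢0 above = ⊥-elim (g≢0 (head-vanishes (y-functional b b<k) refl ann g≢0 above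
      (y-functional-below b b<k) (y-functional-at b b<k)))
    small 1 1 _ _ g≢0 above with head-multiple twisted ann g≢0 above twisted-below twisted-at
    ... | divides z g≡ = # 4 , (0 , 0) , z , refl ,
                         trans g≡ (cong (z *_) (trans (ℤP.*-identityˡ (+ (k ℕ.∸ 2))) (sym (C-at-head (# 4)))))
    small (suc (suc a)) (suc b) _ _ _ _ = # 2 , (a , b) , g (2 ℕ.+ a , suc b) ,
      cong₂ _,_ (ℕP.+-comm a 2) (ℕP.+-comm b 1) , sym (ℤP.*-identityʳ _)
    small 1 (suc (suc b)) _ _ _ _ = # 3 , (0 , b) , g (1 , 2 ℕ.+ b) ,
      cong (1 ,_) (ℕP.+-comm b 2) , sym (ℤP.*-identityʳ _)

  open Completeness Annihilated (λ (d , g≤d , _) → d , g≤d) Annihilated-step head-reducible public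

proposition9 : (k : ℕ) → 4 ℕ.≤ k →
    ((i j : Fin 5) → i < j → ∀ h → IsSPoly (C k i) (C k j) h → DRedZero (C k) h)
    × IsDGroebner (C k)
proposition9 (suc (suc (suc (suc k')))) (s≤s (s≤s (s≤s (s≤s z≤n)))) =
  (λ i j _ h S → reduces-to-zero h (Annihilated-SPoly i j S)) ,
  (λ f f∈I g (steps , irreducible) → normal-form-zero (Good-steps steps (Annihilated-ideal f∈I)) irreducible)
  where open HeadReduction k'
        open Annihilation k'
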